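{- Let $n,b,k$ be non-negative integers with $b$ even, and regard the entries of $\overline{B}$ as polynomials in $a$. For any index set $I=\{i_1<i_2<\cdots<i_s\}\subseteq\{1,\dots,n+b\}$, let $J=I\cup\{n+b+1,\dots,n+2b\}$ and let $\overline{B}_J^J$ be the principal submatrix of $\overline{B}$ with rows and columns indexed by $J$. Then $$\deg_a\det\overline{B}_J^J\le(i_1-1)+(i_2-2)+\cdots+(i_s-s)+2bk-bs.$$
   Context: $\overline{B}$ is the $(n+2b)\times(n+2b)$ block matrix $$\overline{B}=\begin{pmatrix}\binom{a+i+j-2}{j-1}_{1\le i,j\le n+b} & \binom{\frac a2+k+i-1}{2k+j-1}_{1\le i\le n+b,\,1\le j\le b}\\[4pt] \binom{n+a+b+j-1}{j-i}_{1\le i\le b,\,1\le j\le n+b} & \binom{n+\frac a2+b+k}{2k+j-i}_{1\le i,j\le b}\end{pmatrix},$$ where $\binom{x}{m}=x(x-1)\cdots(x-m+1)/m!$ for integers $m\ge0$ and $0$ for $m<0$, so all entries are polynomials in $a$. -}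

module Defs where

open import Data.Nat as ℕ using (ℕ; zero; suc)
open import Data.Nat.Base using (_!)
open import Data.Nat.Properties using (_!≢0)
open import Data.Integer as ℤ using (ℤ; +_; -[1+_])
open import Data.Rational as ℚ using (ℚ; 0ℚ; 1ℚ; ½)
open import Data.List using (List; []; _∷_)
open import Data.Fin as Fin using (Fin; zero; suc; toℕ; splitAt; join; punchIn)
open import Data.Sum using (inj₁; inj₂)
import Data.Sum as Sum
open import Relation.Binary.PropositionalEquality using (_≡_)

-- Univariate polynomials in the variable a with rational coefficients,
-- represented by coefficient lists (constant term first).

Poly : Set
Poly = List ℚ

coeff : Poly → ℕ → ℚ
coeff []       _       = 0ℚ
coeff (c ∷ p)  zero    = c
coeff (c ∷ p)  (suc m) = coeff p m

_+ₚ_ : Poly → Poly → Poly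
[]      +ₚ q       = q
(c ∷ p) +ₚ []      = c ∷ p
(c ∷ p) +ₚ (d ∷ q) = (c ℚ.+ d) ∷ (p +ₚ q)

scaleₚ : ℚ → Poly → Poly
scaleₚ c []      = []
scaleₚ c (d ∷ q) = (c ℚ.* d) ∷ scaleₚ c q

_*ₚ_ : Poly → Poly → Poly
[]      *ₚ q = []
(c ∷ p) *ₚ q = scaleₚ c q +ₚ (0ℚ ∷ (p *ₚ q))

constₚ : ℚ → Poly
constₚ c = c ∷ []

natₚ : ℕ → Poly
natₚ n = constₚ (+ n ℚ./ 1)

0ₚ 1ₚ : Poly
0ₚ = []
1ₚ = constₚ 1ℚ

Xₚ : Poly
Xₚ = 0ℚ ∷ 1ℚ ∷ []

halfXₚ : Poly
halfXₚ = 0ℚ ∷ ½ ∷ []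

-- Degree bound with the convention deg 0 = -∞:
-- deg p ≤ d  iff  every coefficient of a^m with m > d vanishes.
DegLe : Poly → ℤ → Set
DegLe p d = (m : ℕ) → d ℤ.< + m → coeff p m ≡ 0ℚ


falling : Poly → ℕ → Poly
falling x zero    = 1ₚ
falling x (suc m) = falling x m *ₚ (x +ₚ constₚ (ℚ.- (+ m ℚ./ 1)))

binomₚ : Poly → ℤ → Poly
binomₚ x (+ m)    = scaleₚ ((+ 1 ℚ./ (m !)) {{m !≢0}}) (falling x m)
binomₚ x -[1+ _ ] = 0ₚ

signₚ : ℕ → Poly → Poly
signₚ zero          p = p
signₚ (suc zero)    p = scaleₚ (ℚ.- 1ℚ) p
signₚ (suc (suc j)) p = signₚ j p

sumFinₚ : (m : ℕ) → (Fin m → Poly) → Poly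
sumFinₚ zero    f = 0ₚ
sumFinₚ (suc m) f = f zero +ₚ sumFinₚ m (λ j → f (suc j))

det : (m : ℕ) → (Fin m → Fin m → Poly) → Poly
det zero    M = 1ₚ
det (suc m) M = sumFinₚ (suc m) λ j →
  signₚ (toℕ j) (M zero j *ₚ det m (λ r c → M (suc r) (punchIn j c)))

sumFinℤ : (m : ℕ) → (Fin m → ℤ) → ℤ
sumFinℤ zero    f = + 0
sumFinℤ (suc m) f = f zero ℤ.+ sumFinℤ m (λ j → f (suc j))

-- The matrix  B̄  of size (n+b)+b = n+2b, with 0-based indices.
-- Row r / column c in the first block correspond to i = r+1, j = c+1;
-- in the second block to i = r'+1, j = c'+1 with r = n+b+r' etc.

Bbar : (n b k : ℕ) → Fin ((n ℕ.+ b) ℕ.+ b) → Fin ((n ℕ.+ b) ℕ.+ b) → Poly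
Bbar n b k r c with splitAt (n ℕ.+ b) r | splitAt (n ℕ.+ b) c
... | inj₁ i | inj₁ j =   -- binom(a+i+j-2, j-1)
  binomₚ (Xₚ +ₚ natₚ (toℕ i ℕ.+ toℕ j)) (+ toℕ j)
... | inj₁ i | inj₂ j =   -- binom(a/2+k+i-1, 2k+j-1)
  binomₚ (halfXₚ +ₚ natₚ (k ℕ.+ toℕ i)) (+ (2 ℕ.* k ℕ.+ toℕ j))
... | inj₂ i | inj₁ j =   -- binom(n+a+b+j-1, j-i)
  binomₚ (Xₚ +ₚ natₚ (n ℕ.+ b ℕ.+ toℕ j)) (+ toℕ j ℤ.- + toℕ i)
... | inj₂ i | inj₂ j =   -- binom(n+a/2+b+k, 2k+j-i)
  binomₚ (halfXₚ +ₚ natₚ (n ℕ.+ b ℕ.+ k)) (+ (2 ℕ.* k ℕ.+ toℕ j) ℤ.- + toℕ i)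

-- Given I = {ι 0 < ι 1 < ... < ι (s-1)} ⊆ {0,..,n+b-1} (0-based),
-- the index set J = I ∪ {n+b, ..., n+2b-1} as a map Fin (s+b) → Fin (n+2b).
Jidx : (n b s : ℕ) → (Fin s → Fin (n ℕ.+ b)) → Fin (s ℕ.+ b) → Fin ((n ℕ.+ b) ℕ.+ b)
Jidx n b s ι t = join (n ℕ.+ b) b (Sum.map₁ ι (splitAt s t))

BbarJJ : (n b k s : ℕ) → (Fin s → Fin (n ℕ.+ b)) → Fin (s ℕ.+ b) → Fin (s ℕ.+ b) → Poly
BbarJJ n b k s ι r c = Bbar n b k (Jidx n b s ι r) (Jidx n b s ι c)

module Submission where

-- Give column c of M = B̄_J^J the weight v c (ι i in the first block, 2k + j
-- in the second) and the variable x_c (a + ι i, resp. a/2 + k), and let R l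
-- be the row c ↦ binom(x_c, v c - l), whose entries have degree ≤ v c - l.
-- By Vandermonde's identity every row of M is a rational combination of
-- rows R l, so by multilinearity det M is a combination of determinants
-- whose r-th row is R (h r).  Those with h non-injective vanish
-- (alternation); the others have degree ≤ Σ v - Σ h ≤ Σ v - (0 + ... +
-- (s+b-1)), which is the claimed bound.

open import Defs
open import Data.Nat as ℕ using (ℕ; zero; suc)
open import Data.Nat.Divisibility using (_∣_)
open import Data.Integer as ℤ using (ℤ; +_; -[1+_])
open import Data.Fin as Fin using (Fin; zero; suc; toℕ; punchIn)
open import Data.Rational as ℚ using (ℚ; 0ℚ; 1ℚ)
open import Data.List using ([]; _∷_)
open import Data.Product using (Σ; _×_; _,_)
open import Data.Sum as Sum using (_⊎_; inj₁; inj₂)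
open import Data.Unit using (⊤; tt)
open import Data.Empty using (⊥-elim)
open import Relation.Nullary using (yes; no)
open import Relation.Nullary.Decidable using (_×-dec_; ¬?)
open import Relation.Binary.Bundles using (Setoid)
import Relation.Binary.Reasoning.Setoid
open import Relation.Binary.PropositionalEquality
import Data.Nat.Properties as ℕP
import Data.Integer.Properties as ℤP
import Data.Fin.Properties as FinP
import Data.Rational.Properties as ℚP
open import Data.Rational.Unnormalised as ℚᵘ using (mkℚᵘ)
import Data.Rational.Unnormalised.Properties as ℚᵘP
import Data.Rational.Solver
import Data.Empty.Irrelevant as Irrelevant
open import Data.Nat.Combinatorics using (nCk+nC[k+1]≡[n+1]C[k+1])
  renaming (_C_ to _choose_)
open import Data.Integer.Tactic.RingSolver using (solve-∀)
import Data.Nat.Tactic.RingSolver as ℕSolver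

-- Polynomial arithmetic up to coefficientwise equality

-- Coefficient lists with trailing zeros represent the same polynomial, so
-- all algebra is done modulo equality of every coefficient.
infix 4 _≈_
record _≈_ (p q : Poly) : Set where
  constructor mk≈
  field app : ∀ m → coeff p m ≡ coeff q m
open _≈_ public

≈-refl : ∀ {p} → p ≈ p
≈-refl = mk≈ λ m → refl

≈-sym : ∀ {p q} → p ≈ q → q ≈ p
≈-sym e = mk≈ λ m → sym (app e m)

≈-trans : ∀ {p q r} → p ≈ q → q ≈ r → p ≈ r
≈-trans e f = mk≈ λ m → trans (app e m) (app f m)

≈-reflexive : ∀ {p q} → p ≡ q → p ≈ q
≈-reflexive refl = ≈-refl

≈-setoid : Setoid _ _
≈-setoid = record
  { Carrier = Poly ; _≈_ = _≈_
  ; isEquivalence = record { refl = ≈-refl ; sym = ≈-sym ; trans = ≈-trans } }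

module ≈-Reasoning = Relation.Binary.Reasoning.Setoid ≈-setoid

coeff-+ : ∀ p q m → coeff (p +ₚ q) m ≡ coeff p m ℚ.+ coeff q m
coeff-+ []      q       m       = sym (ℚP.+-identityˡ (coeff q m))
coeff-+ (c ∷ p) []      m       = sym (ℚP.+-identityʳ (coeff (c ∷ p) m))
coeff-+ (c ∷ p) (d ∷ q) zero    = refl
coeff-+ (c ∷ p) (d ∷ q) (suc m) = coeff-+ p q m

coeff-scale : ∀ c p m → coeff (scaleₚ c p) m ≡ c ℚ.* coeff p m
coeff-scale c []      m       = sym (ℚP.*-zeroʳ c)
coeff-scale c (d ∷ p) zero    = refl
coeff-scale c (d ∷ p) (suc m) = coeff-scale c p m

∷-cong : ∀ {c c' p p'} → c ≡ c' → p ≈ p' → (c ∷ p) ≈ (c' ∷ p')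
∷-cong e f = mk≈ λ { zero → e ; (suc m) → app f m }

+-cong : ∀ {p p' q q'} → p ≈ p' → q ≈ q' → (p +ₚ q) ≈ (p' +ₚ q')
+-cong {p} {p'} {q} {q'} e f = mk≈ λ m →
  trans (coeff-+ p q m) (trans (cong₂ ℚ._+_ (app e m) (app f m)) (sym (coeff-+ p' q' m)))

+-congˡ : ∀ p {q q'} → q ≈ q' → (p +ₚ q) ≈ (p +ₚ q')
+-congˡ p = +-cong (≈-refl {p})

scale-cong : ∀ {c c' p p'} → c ≡ c' → p ≈ p' → scaleₚ c p ≈ scaleₚ c' p'
scale-cong {c} {c'} {p} {p'} refl f = mk≈ λ m →
  trans (coeff-scale c p m) (trans (cong (c ℚ.*_) (app f m)) (sym (coeff-scale c p' m)))

+-comm : ∀ p q → (p +ₚ q) ≈ (q +ₚ p)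
+-comm p q = mk≈ λ m →
  trans (coeff-+ p q m) (trans (ℚP.+-comm (coeff p m) (coeff q m)) (sym (coeff-+ q p m)))

+-assoc : ∀ p q r → ((p +ₚ q) +ₚ r) ≈ (p +ₚ (q +ₚ r))
+-assoc p q r = mk≈ λ m → begin
    coeff ((p +ₚ q) +ₚ r) m                  ≡⟨ coeff-+ (p +ₚ q) r m ⟩
    coeff (p +ₚ q) m ℚ.+ coeff r m           ≡⟨ cong (ℚ._+ coeff r m) (coeff-+ p q m) ⟩
    (coeff p m ℚ.+ coeff q m) ℚ.+ coeff r m  ≡⟨ ℚP.+-assoc (coeff p m) (coeff q m) (coeff r m) ⟩
    coeff p m ℚ.+ (coeff q m ℚ.+ coeff r m)  ≡⟨ cong (coeff p m ℚ.+_) (coeff-+ q r m) ⟨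
    coeff p m ℚ.+ coeff (q +ₚ r) m           ≡⟨ coeff-+ p (q +ₚ r) m ⟨
    coeff (p +ₚ (q +ₚ r)) m                  ∎
  where open ≡-Reasoning

+-identityʳ : ∀ p → (p +ₚ []) ≈ p
+-identityʳ p = mk≈ λ m → trans (coeff-+ p [] m) (ℚP.+-identityʳ (coeff p m))

+-interchange : ∀ p q r s → ((p +ₚ q) +ₚ (r +ₚ s)) ≈ ((p +ₚ r) +ₚ (q +ₚ s))
+-interchange p q r s = begin
  (p +ₚ q) +ₚ (r +ₚ s) ≈⟨ +-assoc p q (r +ₚ s) ⟩
  p +ₚ (q +ₚ (r +ₚ s)) ≈⟨ +-congˡ p (+-assoc q r s) ⟨
  p +ₚ ((q +ₚ r) +ₚ s) ≈⟨ +-congˡ p (+-cong (+-comm q r) (≈-refl {s})) ⟩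
  p +ₚ ((r +ₚ q) +ₚ s) ≈⟨ +-congˡ p (+-assoc r q s) ⟩
  p +ₚ (r +ₚ (q +ₚ s)) ≈⟨ +-assoc p r (q +ₚ s) ⟨
  (p +ₚ r) +ₚ (q +ₚ s) ∎
  where open ≈-Reasoning

+-[]ˡ : ∀ {p q} → p ≈ [] → (p +ₚ q) ≈ q
+-[]ˡ {p} {q} e = mk≈ λ m → trans (coeff-+ p q m)
  (trans (cong (ℚ._+ coeff q m) (app e m)) (ℚP.+-identityˡ (coeff q m)))

+-[]ʳ : ∀ {p q} → q ≈ [] → (p +ₚ q) ≈ p
+-[]ʳ {p} {q} e = mk≈ λ m → trans (coeff-+ p q m)
  (trans (cong (coeff p m ℚ.+_) (app e m)) (ℚP.+-identityʳ (coeff p m)))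

scale-+ₚ : ∀ c p q → scaleₚ c (p +ₚ q) ≈ (scaleₚ c p +ₚ scaleₚ c q)
scale-+ₚ c p q = mk≈ λ m → begin
  coeff (scaleₚ c (p +ₚ q)) m                    ≡⟨ coeff-scale c (p +ₚ q) m ⟩
  c ℚ.* coeff (p +ₚ q) m                         ≡⟨ cong (c ℚ.*_) (coeff-+ p q m) ⟩
  c ℚ.* (coeff p m ℚ.+ coeff q m)                ≡⟨ ℚP.*-distribˡ-+ c (coeff p m) (coeff q m) ⟩
  c ℚ.* coeff p m ℚ.+ c ℚ.* coeff q m            ≡⟨ cong₂ ℚ._+_ (coeff-scale c p m) (coeff-scale c q m) ⟨
  coeff (scaleₚ c p) m ℚ.+ coeff (scaleₚ c q) m  ≡⟨ coeff-+ (scaleₚ c p) (scaleₚ c q) m ⟨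
  coeff (scaleₚ c p +ₚ scaleₚ c q) m             ∎
  where open ≡-Reasoning

scale-+ℚ : ∀ c d p → scaleₚ (c ℚ.+ d) p ≈ (scaleₚ c p +ₚ scaleₚ d p)
scale-+ℚ c d p = mk≈ λ m → begin
  coeff (scaleₚ (c ℚ.+ d) p) m                   ≡⟨ coeff-scale (c ℚ.+ d) p m ⟩
  (c ℚ.+ d) ℚ.* coeff p m                        ≡⟨ ℚP.*-distribʳ-+ (coeff p m) c d ⟩
  c ℚ.* coeff p m ℚ.+ d ℚ.* coeff p m            ≡⟨ cong₂ ℚ._+_ (coeff-scale c p m) (coeff-scale d p m) ⟨
  coeff (scaleₚ c p) m ℚ.+ coeff (scaleₚ d p) m  ≡⟨ coeff-+ (scaleₚ c p) (scaleₚ d p) m ⟨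
  coeff (scaleₚ c p +ₚ scaleₚ d p) m             ∎
  where open ≡-Reasoning

scale-scale : ∀ c d p → scaleₚ c (scaleₚ d p) ≈ scaleₚ (c ℚ.* d) p
scale-scale c d p = mk≈ λ m →
  trans (coeff-scale c (scaleₚ d p) m) (trans (cong (c ℚ.*_) (coeff-scale d p m))
    (trans (sym (ℚP.*-assoc c d (coeff p m))) (sym (coeff-scale (c ℚ.* d) p m))))

scale-comm : ∀ c d p → scaleₚ c (scaleₚ d p) ≈ scaleₚ d (scaleₚ c p)
scale-comm c d p = ≈-trans (scale-scale c d p)
  (≈-trans (scale-cong (ℚP.*-comm c d) ≈-refl) (≈-sym (scale-scale d c p)))

scale-1 : ∀ p → scaleₚ 1ℚ p ≈ p
scale-1 p = mk≈ λ m → trans (coeff-scale 1ℚ p m) (ℚP.*-identityˡ (coeff p m))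

scale-0 : ∀ p → scaleₚ 0ℚ p ≈ []
scale-0 p = mk≈ λ m → trans (coeff-scale 0ℚ p m) (ℚP.*-zeroˡ (coeff p m))

scale-[] : ∀ c {p} → p ≈ [] → scaleₚ c p ≈ []
scale-[] c {p} e = mk≈ λ m →
  trans (coeff-scale c p m) (trans (cong (c ℚ.*_) (app e m)) (ℚP.*-zeroʳ c))

-- Facts about the shift p ↦ 0 ∷ p, i.e. multiplication by a.
0∷[]≈[] : (0ℚ ∷ []) ≈ []
0∷[]≈[] = mk≈ λ { zero → refl ; (suc m) → refl }

0∷-[] : ∀ {p} → p ≈ [] → (0ℚ ∷ p) ≈ []
0∷-[] e = mk≈ λ { zero → refl ; (suc m) → app e m }

0∷-+ : ∀ p q → (0ℚ ∷ (p +ₚ q)) ≈ ((0ℚ ∷ p) +ₚ (0ℚ ∷ q))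
0∷-+ p q = mk≈ λ { zero → sym (ℚP.+-identityˡ 0ℚ) ; (suc m) → refl }

scale-0∷ : ∀ c p → scaleₚ c (0ℚ ∷ p) ≈ (0ℚ ∷ scaleₚ c p)
scale-0∷ c p = mk≈ λ { zero → ℚP.*-zeroʳ c ; (suc m) → refl }

∷-split : ∀ c p → (c ∷ p) ≈ ((c ∷ []) +ₚ (0ℚ ∷ p))
∷-split c p = mk≈ λ { zero → sym (ℚP.+-identityʳ c) ; (suc m) → refl }

*-congʳ : ∀ p {q q'} → q ≈ q' → (p *ₚ q) ≈ (p *ₚ q')
*-congʳ []      e = ≈-refl
*-congʳ (c ∷ p) e = +-cong (scale-cong refl e) (∷-cong refl (*-congʳ p e))

*-[]ˡ : ∀ {p} q → p ≈ [] → (p *ₚ q) ≈ []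
*-[]ˡ {[]}    q e = ≈-refl
*-[]ˡ {c ∷ p} q e = begin
  scaleₚ c q +ₚ (0ℚ ∷ (p *ₚ q))
    ≈⟨ +-cong (scale-cong (app e zero) ≈-refl) (∷-cong refl (*-[]ˡ q tail≈[])) ⟩
  scaleₚ 0ℚ q +ₚ (0ℚ ∷ [])
    ≈⟨ +-[]ˡ (scale-0 q) ⟩
  0ℚ ∷ []
    ≈⟨ 0∷[]≈[] ⟩
  [] ∎
  where
    open ≈-Reasoning
    tail≈[] : p ≈ []
    tail≈[] = mk≈ λ m → app e (suc m)

*-[]ʳ : ∀ p → (p *ₚ []) ≈ []
*-[]ʳ []      = ≈-refl
*-[]ʳ (c ∷ p) = 0∷-[] (*-[]ʳ p)

*-congˡ : ∀ {p p'} q → p ≈ p' → (p *ₚ q) ≈ (p' *ₚ q)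
*-congˡ {[]}    {[]}      q e = ≈-refl
*-congˡ {[]}    {c' ∷ p'} q e = ≈-sym (*-[]ˡ q (≈-sym e))
*-congˡ {c ∷ p} {[]}      q e = *-[]ˡ q e
*-congˡ {c ∷ p} {c' ∷ p'} q e =
  +-cong (scale-cong (app e zero) ≈-refl) (∷-cong refl (*-congˡ {p} {p'} q (mk≈ λ m → app e (suc m))))

*-cong : ∀ {p p' q q'} → p ≈ p' → q ≈ q' → (p *ₚ q) ≈ (p' *ₚ q')
*-cong {p} {p'} {q} e f = ≈-trans (*-congˡ q e) (*-congʳ p' f)

*-distribʳ : ∀ p q r → ((p +ₚ q) *ₚ r) ≈ ((p *ₚ r) +ₚ (q *ₚ r))
*-distribʳ []      q       r = ≈-refl
*-distribʳ (c ∷ p) []      r = ≈-sym (+-identityʳ _)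
*-distribʳ (c ∷ p) (d ∷ q) r = begin
  scaleₚ (c ℚ.+ d) r +ₚ (0ℚ ∷ ((p +ₚ q) *ₚ r))
    ≈⟨ +-cong (scale-+ℚ c d r) (≈-trans (∷-cong refl (*-distribʳ p q r)) (0∷-+ (p *ₚ r) (q *ₚ r))) ⟩
  (scaleₚ c r +ₚ scaleₚ d r) +ₚ ((0ℚ ∷ (p *ₚ r)) +ₚ (0ℚ ∷ (q *ₚ r)))
    ≈⟨ +-interchange (scaleₚ c r) (scaleₚ d r) (0ℚ ∷ (p *ₚ r)) (0ℚ ∷ (q *ₚ r)) ⟩
  (scaleₚ c r +ₚ (0ℚ ∷ (p *ₚ r))) +ₚ (scaleₚ d r +ₚ (0ℚ ∷ (q *ₚ r))) ∎
  where open ≈-Reasoning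

*-distribˡ : ∀ p q r → (p *ₚ (q +ₚ r)) ≈ ((p *ₚ q) +ₚ (p *ₚ r))
*-distribˡ []      q r = ≈-refl
*-distribˡ (c ∷ p) q r = begin
  scaleₚ c (q +ₚ r) +ₚ (0ℚ ∷ (p *ₚ (q +ₚ r)))
    ≈⟨ +-cong (scale-+ₚ c q r) (≈-trans (∷-cong refl (*-distribˡ p q r)) (0∷-+ (p *ₚ q) (p *ₚ r))) ⟩
  (scaleₚ c q +ₚ scaleₚ c r) +ₚ ((0ℚ ∷ (p *ₚ q)) +ₚ (0ℚ ∷ (p *ₚ r)))
    ≈⟨ +-interchange (scaleₚ c q) (scaleₚ c r) (0ℚ ∷ (p *ₚ q)) (0ℚ ∷ (p *ₚ r)) ⟩
  (scaleₚ c q +ₚ (0ℚ ∷ (p *ₚ q))) +ₚ (scaleₚ c r +ₚ (0ℚ ∷ (p *ₚ r))) ∎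
  where open ≈-Reasoning

scale-0∷-+ : ∀ c p q → (scaleₚ c p +ₚ (0ℚ ∷ scaleₚ c q)) ≈ scaleₚ c (p +ₚ (0ℚ ∷ q))
scale-0∷-+ c p q = ≈-trans (+-congˡ (scaleₚ c p) (≈-sym (scale-0∷ c q))) (≈-sym (scale-+ₚ c p (0ℚ ∷ q)))

*-scaleˡ : ∀ c p q → (scaleₚ c p *ₚ q) ≈ scaleₚ c (p *ₚ q)
*-scaleˡ c []      q = ≈-refl
*-scaleˡ c (d ∷ p) q = begin
  scaleₚ (c ℚ.* d) q +ₚ (0ℚ ∷ (scaleₚ c p *ₚ q))
    ≈⟨ +-cong (≈-sym (scale-scale c d q)) (∷-cong refl (*-scaleˡ c p q)) ⟩
  scaleₚ c (scaleₚ d q) +ₚ (0ℚ ∷ scaleₚ c (p *ₚ q))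
    ≈⟨ scale-0∷-+ c (scaleₚ d q) (p *ₚ q) ⟩
  scaleₚ c (scaleₚ d q +ₚ (0ℚ ∷ (p *ₚ q))) ∎
  where open ≈-Reasoning

*-scaleʳ : ∀ c p q → (p *ₚ scaleₚ c q) ≈ scaleₚ c (p *ₚ q)
*-scaleʳ c []      q = ≈-refl
*-scaleʳ c (d ∷ p) q = begin
  scaleₚ d (scaleₚ c q) +ₚ (0ℚ ∷ (p *ₚ scaleₚ c q))
    ≈⟨ +-cong (scale-comm d c q) (∷-cong refl (*-scaleʳ c p q)) ⟩
  scaleₚ c (scaleₚ d q) +ₚ (0ℚ ∷ scaleₚ c (p *ₚ q))
    ≈⟨ scale-0∷-+ c (scaleₚ d q) (p *ₚ q) ⟩
  scaleₚ c (scaleₚ d q +ₚ (0ℚ ∷ (p *ₚ q))) ∎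
  where open ≈-Reasoning

*-shiftʳ : ∀ p q → (p *ₚ (0ℚ ∷ q)) ≈ (0ℚ ∷ (p *ₚ q))
*-shiftʳ []      q = ≈-sym 0∷[]≈[]
*-shiftʳ (c ∷ p) q = begin
  scaleₚ c (0ℚ ∷ q) +ₚ (0ℚ ∷ (p *ₚ (0ℚ ∷ q)))
    ≈⟨ +-cong (scale-0∷ c q) (∷-cong refl (*-shiftʳ p q)) ⟩
  (0ℚ ∷ scaleₚ c q) +ₚ (0ℚ ∷ (0ℚ ∷ (p *ₚ q)))
    ≈⟨ 0∷-+ (scaleₚ c q) (0ℚ ∷ (p *ₚ q)) ⟨
  0ℚ ∷ (scaleₚ c q +ₚ (0ℚ ∷ (p *ₚ q))) ∎
  where open ≈-Reasoning

*-shiftˡ : ∀ p q → ((0ℚ ∷ p) *ₚ q) ≈ (0ℚ ∷ (p *ₚ q))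
*-shiftˡ p q = +-[]ˡ (scale-0 q)

*-constʳ : ∀ p c → (p *ₚ (c ∷ [])) ≈ scaleₚ c p
*-constʳ []      c = ≈-refl
*-constʳ (d ∷ p) c = begin
  scaleₚ d (c ∷ []) +ₚ (0ℚ ∷ (p *ₚ (c ∷ [])))
    ≈⟨ +-cong (∷-cong (ℚP.*-comm d c) ≈-refl) (∷-cong refl (*-constʳ p c)) ⟩
  ((c ℚ.* d) ∷ []) +ₚ (0ℚ ∷ scaleₚ c p)
    ≈⟨ ∷-split (c ℚ.* d) (scaleₚ c p) ⟨
  scaleₚ c (d ∷ p) ∎
  where open ≈-Reasoning

*-comm : ∀ p q → (p *ₚ q) ≈ (q *ₚ p)
*-comm []      q = ≈-sym (*-[]ʳ q)
*-comm (c ∷ p) q = begin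
  scaleₚ c q +ₚ (0ℚ ∷ (p *ₚ q))         ≈⟨ +-cong (≈-sym (*-constʳ q c)) (∷-cong refl (*-comm p q)) ⟩
  (q *ₚ (c ∷ [])) +ₚ (0ℚ ∷ (q *ₚ p))    ≈⟨ +-congˡ (q *ₚ (c ∷ [])) (*-shiftʳ q p) ⟨
  (q *ₚ (c ∷ [])) +ₚ (q *ₚ (0ℚ ∷ p))    ≈⟨ *-distribˡ q (c ∷ []) (0ℚ ∷ p) ⟨
  q *ₚ ((c ∷ []) +ₚ (0ℚ ∷ p))           ≈⟨ *-congʳ q (∷-split c p) ⟨
  q *ₚ (c ∷ p)                          ∎
  where open ≈-Reasoning

*-assoc : ∀ p q r → ((p *ₚ q) *ₚ r) ≈ (p *ₚ (q *ₚ r))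
*-assoc []      q r = ≈-refl
*-assoc (c ∷ p) q r = begin
  (scaleₚ c q +ₚ (0ℚ ∷ (p *ₚ q))) *ₚ r
    ≈⟨ *-distribʳ (scaleₚ c q) (0ℚ ∷ (p *ₚ q)) r ⟩
  (scaleₚ c q *ₚ r) +ₚ ((0ℚ ∷ (p *ₚ q)) *ₚ r)
    ≈⟨ +-cong (*-scaleˡ c q r) (≈-trans (*-shiftˡ (p *ₚ q) r) (∷-cong refl (*-assoc p q r))) ⟩
  scaleₚ c (q *ₚ r) +ₚ (0ℚ ∷ (p *ₚ (q *ₚ r))) ∎
  where open ≈-Reasoning

*-identityˡ : ∀ p → (1ₚ *ₚ p) ≈ p
*-identityˡ p = ≈-trans (+-[]ʳ 0∷[]≈[]) (scale-1 p)

*-identityʳ : ∀ p → (p *ₚ 1ₚ) ≈ p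
*-identityʳ p = ≈-trans (*-constʳ p 1ℚ) (scale-1 p)

*-swap : ∀ p q r → (p *ₚ (q *ₚ r)) ≈ (q *ₚ (p *ₚ r))
*-swap p q r = ≈-trans (≈-sym (*-assoc p q r)) (≈-trans (*-congˡ r (*-comm p q)) (*-assoc q p r))

negₚ : Poly → Poly
negₚ = scaleₚ (ℚ.- 1ℚ)

neg-cong : ∀ {p q} → p ≈ q → negₚ p ≈ negₚ q
neg-cong = scale-cong refl

neg-neg : ∀ p → negₚ (negₚ p) ≈ p
neg-neg p = ≈-trans (scale-scale (ℚ.- 1ℚ) (ℚ.- 1ℚ) p) (scale-1 p)

+-negʳ : ∀ p → (p +ₚ negₚ p) ≈ []
+-negʳ p = begin
  p +ₚ negₚ p                       ≈⟨ +-cong (≈-sym (scale-1 p)) (≈-refl {negₚ p}) ⟩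
  scaleₚ 1ℚ p +ₚ scaleₚ (ℚ.- 1ℚ) p  ≈⟨ scale-+ℚ 1ℚ (ℚ.- 1ℚ) p ⟨
  scaleₚ (1ℚ ℚ.+ ℚ.- 1ℚ) p          ≈⟨ scale-cong (ℚP.+-inverseʳ 1ℚ) ≈-refl ⟩
  scaleₚ 0ℚ p                       ≈⟨ scale-0 p ⟩
  []                                ∎
  where open ≈-Reasoning

lin : ℚ → ℚ → Poly → Poly → Poly
lin α β p q = scaleₚ α p +ₚ scaleₚ β q

lin-cong : ∀ α β {p p' q q'} → p ≈ p' → q ≈ q' → lin α β p q ≈ lin α β p' q'
lin-cong α β e f = +-cong (scale-cong refl e) (scale-cong refl f)

lin-1-1 : ∀ p q → lin 1ℚ 1ℚ p q ≈ (p +ₚ q)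
lin-1-1 p q = +-cong (scale-1 p) (scale-1 q)

lin-scale : ∀ α β c p q → scaleₚ c (lin α β p q) ≈ lin α β (scaleₚ c p) (scaleₚ c q)
lin-scale α β c p q = ≈-trans (scale-+ₚ c (scaleₚ α p) (scaleₚ β q))
  (+-cong (scale-comm c α p) (scale-comm c β q))

lin-*ʳ : ∀ α β p q r → (lin α β p q *ₚ r) ≈ lin α β (p *ₚ r) (q *ₚ r)
lin-*ʳ α β p q r = ≈-trans (*-distribʳ (scaleₚ α p) (scaleₚ β q) r)
  (+-cong (*-scaleˡ α p r) (*-scaleˡ β q r))

lin-*ˡ : ∀ α β p q r → (r *ₚ lin α β p q) ≈ lin α β (r *ₚ p) (r *ₚ q)
lin-*ˡ α β p q r = ≈-trans (*-distribˡ r (scaleₚ α p) (scaleₚ β q))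
  (+-cong (*-scaleʳ α r p) (*-scaleʳ β r q))

signℚ : ℕ → ℚ
signℚ zero          = 1ℚ
signℚ (suc zero)    = ℚ.- 1ℚ
signℚ (suc (suc n)) = signℚ n

sign≈ : ∀ n p → signₚ n p ≈ scaleₚ (signℚ n) p
sign≈ zero          p = ≈-sym (scale-1 p)
sign≈ (suc zero)    p = ≈-refl
sign≈ (suc (suc n)) p = sign≈ n p

signℚ-suc : ∀ n → signℚ (suc n) ≡ ℚ.- 1ℚ ℚ.* signℚ n
signℚ-suc zero    = refl
signℚ-suc (suc n) = begin
  signℚ n                              ≡⟨ ℚP.*-identityˡ (signℚ n) ⟨
  (ℚ.- 1ℚ ℚ.* ℚ.- 1ℚ) ℚ.* signℚ n      ≡⟨ ℚP.*-assoc (ℚ.- 1ℚ) (ℚ.- 1ℚ) (signℚ n) ⟩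
  ℚ.- 1ℚ ℚ.* (ℚ.- 1ℚ ℚ.* signℚ n)      ≡⟨ cong (ℚ.- 1ℚ ℚ.*_) (signℚ-suc n) ⟨
  ℚ.- 1ℚ ℚ.* signℚ (suc n)             ∎
  where open ≡-Reasoning

sign-cong : ∀ n {p q} → p ≈ q → signₚ n p ≈ signₚ n q
sign-cong n {p} {q} e = ≈-trans (sign≈ n p) (≈-trans (scale-cong refl e) (≈-sym (sign≈ n q)))

sign-suc : ∀ n p → signₚ (suc n) p ≈ negₚ (signₚ n p)
sign-suc n p = begin
  signₚ (suc n) p                    ≈⟨ sign≈ (suc n) p ⟩
  scaleₚ (signℚ (suc n)) p           ≈⟨ scale-cong (signℚ-suc n) ≈-refl ⟩
  scaleₚ (ℚ.- 1ℚ ℚ.* signℚ n) p      ≈⟨ scale-scale (ℚ.- 1ℚ) (signℚ n) p ⟨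
  negₚ (scaleₚ (signℚ n) p)          ≈⟨ neg-cong (sign≈ n p) ⟨
  negₚ (signₚ n p)                   ∎
  where open ≈-Reasoning

sign-suc-suc : ∀ a b p → signₚ (suc a) (signₚ (suc b) p) ≈ signₚ a (signₚ b p)
sign-suc-suc a b p = begin
  signₚ (suc a) (signₚ (suc b) p)     ≈⟨ sign-suc a _ ⟩
  negₚ (signₚ a (signₚ (suc b) p))    ≈⟨ neg-cong (sign-cong a (sign-suc b p)) ⟩
  negₚ (signₚ a (negₚ (signₚ b p)))   ≈⟨ neg-cong sign-neg ⟩
  negₚ (negₚ (signₚ a (signₚ b p)))   ≈⟨ neg-neg _ ⟩
  signₚ a (signₚ b p)                 ∎
  where
    open ≈-Reasoning
    sign-neg : signₚ a (negₚ (signₚ b p)) ≈ negₚ (signₚ a (signₚ b p))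
    sign-neg = ≈-trans (sign≈ a _) (≈-trans (scale-comm (signℚ a) (ℚ.- 1ℚ) _)
                 (neg-cong (≈-sym (sign≈ a _))))

sign-lin : ∀ n α β p q → signₚ n (lin α β p q) ≈ lin α β (signₚ n p) (signₚ n q)
sign-lin n α β p q = ≈-trans (sign≈ n _) (≈-trans (lin-scale α β (signℚ n) p q)
  (lin-cong α β (≈-sym (sign≈ n p)) (≈-sym (sign≈ n q))))

sign-[] : ∀ n {p} → p ≈ [] → signₚ n p ≈ []
sign-[] n {p} e = ≈-trans (sign≈ n p) (scale-[] (signℚ n) e)

sign-+ : ∀ n p q → signₚ n (p +ₚ q) ≈ (signₚ n p +ₚ signₚ n q)
sign-+ n p q = ≈-trans (sign≈ n _)
  (≈-trans (scale-+ₚ (signℚ n) p q) (≈-sym (+-cong (sign≈ n p) (sign≈ n q))))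

sign-*ʳ : ∀ n p q → (p *ₚ signₚ n q) ≈ signₚ n (p *ₚ q)
sign-*ʳ n p q = ≈-trans (*-congʳ p (sign≈ n q))
  (≈-trans (*-scaleʳ (signℚ n) p q) (≈-sym (sign≈ n _)))

sum-cong : ∀ m {f g : Fin m → Poly} → (∀ j → f j ≈ g j) → sumFinₚ m f ≈ sumFinₚ m g
sum-cong zero    e = ≈-refl
sum-cong (suc m) e = +-cong (e zero) (sum-cong m (λ j → e (suc j)))

sum-[] : ∀ m {f : Fin m → Poly} → (∀ j → f j ≈ []) → sumFinₚ m f ≈ []
sum-[] zero    e = ≈-refl
sum-[] (suc m) e = ≈-trans (+-[]ˡ (e zero)) (sum-[] m (λ j → e (suc j)))

sum-+ : ∀ m (f g : Fin m → Poly) → sumFinₚ m (λ j → f j +ₚ g j) ≈ (sumFinₚ m f +ₚ sumFinₚ m g)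
sum-+ zero    f g = ≈-refl
sum-+ (suc m) f g = ≈-trans (+-congˡ (f zero +ₚ g zero) (sum-+ m (λ j → f (suc j)) (λ j → g (suc j))))
  (+-interchange (f zero) (g zero) _ _)

sum-scale : ∀ m c (f : Fin m → Poly) → sumFinₚ m (λ j → scaleₚ c (f j)) ≈ scaleₚ c (sumFinₚ m f)
sum-scale zero    c f = ≈-refl
sum-scale (suc m) c f = ≈-trans (+-congˡ (scaleₚ c (f zero)) (sum-scale m c (λ j → f (suc j))))
  (≈-sym (scale-+ₚ c (f zero) _))

sum-lin : ∀ m α β (f g : Fin m → Poly) →
  sumFinₚ m (λ j → lin α β (f j) (g j)) ≈ lin α β (sumFinₚ m f) (sumFinₚ m g)
sum-lin m α β f g = ≈-trans (sum-+ m (λ j → scaleₚ α (f j)) (λ j → scaleₚ β (g j)))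
  (+-cong (sum-scale m α f) (sum-scale m β g))

sum-sign : ∀ m n (f : Fin m → Poly) → sumFinₚ m (λ j → signₚ n (f j)) ≈ signₚ n (sumFinₚ m f)
sum-sign m n f = ≈-trans (sum-cong m (λ j → sign≈ n (f j)))
  (≈-trans (sum-scale m (signℚ n) f) (≈-sym (sign≈ n _)))

*-sum : ∀ m p (f : Fin m → Poly) → (p *ₚ sumFinₚ m f) ≈ sumFinₚ m (λ j → p *ₚ f j)
*-sum zero    p f = *-[]ʳ p
*-sum (suc m) p f = ≈-trans (*-distribˡ p (f zero) _) (+-congˡ (p *ₚ f zero) (*-sum m p (λ j → f (suc j))))

-- Determinants: congruence and multilinearity in a row

Mat : ℕ → Set
Mat m = Fin m → Fin m → Poly

minor : ∀ {m} → Mat (suc m) → Fin (suc m) → Mat m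
minor M j r c = M (suc r) (punchIn j c)

altSum : ∀ m → (Fin m → Poly) → Poly
altSum m f = sumFinₚ m (λ j → signₚ (toℕ j) (f j))

altSum-cong : ∀ m {f g : Fin m → Poly} → (∀ j → f j ≈ g j) → altSum m f ≈ altSum m g
altSum-cong m e = sum-cong m (λ j → sign-cong (toℕ j) (e j))

altSum-lin : ∀ m α β (f g : Fin m → Poly) →
  altSum m (λ j → lin α β (f j) (g j)) ≈ lin α β (altSum m f) (altSum m g)
altSum-lin m α β f g = ≈-trans (sum-cong m (λ j → sign-lin (toℕ j) α β (f j) (g j)))
  (sum-lin m α β (λ j → signₚ (toℕ j) (f j)) (λ j → signₚ (toℕ j) (g j)))

det-cong : ∀ m {A B : Mat m} → (∀ r c → A r c ≈ B r c) → det m A ≈ det m B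
det-cong zero    e = ≈-refl
det-cong (suc m) e = altSum-cong (suc m) λ j →
  *-cong (e zero j) (det-cong m (λ r c → e (suc r) (punchIn j c)))

det-lin : ∀ m α β (A B C : Mat m) (r : Fin m) →
  (∀ c → C r c ≈ lin α β (A r c) (B r c)) →
  (∀ r' → r' ≢ r → ∀ c → A r' c ≈ C r' c) →
  (∀ r' → r' ≢ r → ∀ c → B r' c ≈ C r' c) →
  det m C ≈ lin α β (det m A) (det m B)
det-lin (suc m) α β A B C zero at-r eA eB = begin
  altSum (suc m) (λ j → C zero j *ₚ det m (minor C j))
    ≈⟨ altSum-cong (suc m) (λ j → ≈-trans (*-congˡ (det m (minor C j)) (at-r j))
                                          (lin-*ʳ α β (A zero j) (B zero j) (det m (minor C j)))) ⟩
  altSum (suc m) (λ j → lin α β (A zero j *ₚ det m (minor C j)) (B zero j *ₚ det m (minor C j)))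
    ≈⟨ altSum-lin (suc m) α β (λ j → A zero j *ₚ det m (minor C j)) (λ j → B zero j *ₚ det m (minor C j)) ⟩
  lin α β (altSum (suc m) (λ j → A zero j *ₚ det m (minor C j)))
          (altSum (suc m) (λ j → B zero j *ₚ det m (minor C j)))
    ≈⟨ lin-cong α β (altSum-cong (suc m) λ j → *-congʳ (A zero j) (det-cong m (minor-A j)))
                    (altSum-cong (suc m) λ j → *-congʳ (B zero j) (det-cong m (minor-B j))) ⟩
  lin α β (det (suc m) A) (det (suc m) B) ∎
  where
    open ≈-Reasoning
    minor-A : ∀ j r c → minor C j r c ≈ minor A j r c
    minor-A j r c = ≈-sym (eA (suc r) (λ ()) (punchIn j c))
    minor-B : ∀ j r c → minor C j r c ≈ minor B j r c
    minor-B j r c = ≈-sym (eB (suc r) (λ ()) (punchIn j c))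
det-lin (suc m) α β A B C (suc r) at-r eA eB = begin
  altSum (suc m) (λ j → C zero j *ₚ det m (minor C j))
    ≈⟨ altSum-cong (suc m) (λ j → ≈-trans (*-congʳ (C zero j) (minor-lin j))
                                          (lin-*ˡ α β (det m (minor A j)) (det m (minor B j)) (C zero j))) ⟩
  altSum (suc m) (λ j → lin α β (C zero j *ₚ det m (minor A j)) (C zero j *ₚ det m (minor B j)))
    ≈⟨ altSum-lin (suc m) α β (λ j → C zero j *ₚ det m (minor A j)) (λ j → C zero j *ₚ det m (minor B j)) ⟩
  lin α β (altSum (suc m) (λ j → C zero j *ₚ det m (minor A j)))
          (altSum (suc m) (λ j → C zero j *ₚ det m (minor B j)))
    ≈⟨ lin-cong α β (altSum-cong (suc m) λ j → *-congˡ (det m (minor A j)) (≈-sym (eA zero (λ ()) j)))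
                    (altSum-cong (suc m) λ j → *-congˡ (det m (minor B j)) (≈-sym (eB zero (λ ()) j))) ⟩
  lin α β (det (suc m) A) (det (suc m) B) ∎
  where
    open ≈-Reasoning
    minor-lin : ∀ j → det m (minor C j) ≈ lin α β (det m (minor A j)) (det m (minor B j))
    minor-lin j = det-lin m α β (minor A j) (minor B j) (minor C j) r (λ c → at-r (punchIn j c))
      (λ r' r'≢r c → eA (suc r') (λ e → r'≢r (FinP.suc-injective e)) (punchIn j c))
      (λ r' r'≢r c → eB (suc r') (λ e → r'≢r (FinP.suc-injective e)) (punchIn j c))

-- Determinants: a matrix with two equal rows has determinant zero

-- Expanding det along rows 0 and 1 gives a double alternating sum over
-- F j j', where the columns used by rows 0 and 1 are j and punchIn j j'.
doubleAltSum : ∀ n → (Fin (suc n) → Fin n → Poly) → Poly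
doubleAltSum n F = altSum (suc n) (λ j → altSum n (F j))

-- F is pair-symmetric if the term for the columns (j, j'') equals the one
-- for (j'', j); this is expressed recursively along the first column.
PairSymmetric : ∀ n → (Fin (suc n) → Fin n → Poly) → Set
PairSymmetric zero    F = ⊤
PairSymmetric (suc n) F =
  (∀ j → F zero j ≈ F (suc j) zero) × PairSymmetric n (λ j j' → F (suc j) (suc j'))

PairSymmetric-cong : ∀ n {F G : Fin (suc n) → Fin n → Poly} →
  (∀ j j' → F j j' ≈ G j j') → PairSymmetric n F → PairSymmetric n G
PairSymmetric-cong zero    e tt = tt
PairSymmetric-cong (suc n) e (first , rest) =
  (λ j → ≈-trans (≈-sym (e zero j)) (≈-trans (first j) (e (suc j) zero))) ,
  PairSymmetric-cong n (λ j j' → e (suc j) (suc j')) rest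

-- The terms of a pair-symmetric double alternating sum cancel in pairs:
-- (0, j+1) against (j+1, 0) with opposite signs, the rest by induction.
doubleAltSum-vanishes : ∀ n F → PairSymmetric n F → doubleAltSum n F ≈ []
doubleAltSum-vanishes zero    F _ = ≈-refl
doubleAltSum-vanishes (suc n) F (first , rest) = begin
  X +ₚ sumFinₚ (suc n) (λ j → signₚ (suc (toℕ j)) (F (suc j) zero +ₚ W j))
    ≈⟨ +-congˡ X (sum-cong (suc n) (λ j → sign-+ (suc (toℕ j)) (F (suc j) zero) (W j))) ⟩
  X +ₚ sumFinₚ (suc n) (λ j → signₚ (suc (toℕ j)) (F (suc j) zero) +ₚ signₚ (suc (toℕ j)) (W j))
    ≈⟨ +-congˡ X (sum-+ (suc n) (λ j → signₚ (suc (toℕ j)) (F (suc j) zero))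
                                (λ j → signₚ (suc (toℕ j)) (W j))) ⟩
  X +ₚ (Y +ₚ Z)
    ≈⟨ +-congˡ X (≈-trans (+-cong Y≈-X Z≈[]) (+-identityʳ (negₚ X))) ⟩
  X +ₚ negₚ X
    ≈⟨ +-negʳ X ⟩
  [] ∎
  where
    open ≈-Reasoning
    W : Fin (suc n) → Poly
    W j = sumFinₚ n (λ j' → signₚ (suc (toℕ j')) (F (suc j) (suc j')))
    X Y Z : Poly
    X = altSum (suc n) (F zero)
    Y = sumFinₚ (suc n) (λ j → signₚ (suc (toℕ j)) (F (suc j) zero))
    Z = sumFinₚ (suc n) (λ j → signₚ (suc (toℕ j)) (W j))
    -- the terms with column 0 in one of the two rows cancel
    Y≈-X : Y ≈ negₚ X
    Y≈-X = ≈-trans (sum-cong (suc n) (λ j → ≈-trans (sign-suc (toℕ j) _)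
                     (neg-cong (sign-cong (toℕ j) (≈-sym (first j))))))
                   (sum-scale (suc n) (ℚ.- 1ℚ) (λ j → signₚ (toℕ j) (F zero j)))
    -- the remaining terms form a smaller pair-symmetric double sum
    Z≈[] : Z ≈ []
    Z≈[] = ≈-trans
      (sum-cong (suc n) (λ j → ≈-trans
        (≈-sym (sum-sign n (suc (toℕ j)) (λ j' → signₚ (suc (toℕ j')) (F (suc j) (suc j')))))
        (≈-trans (sum-cong n (λ j' → sign-suc-suc (toℕ j) (toℕ j') (F (suc j) (suc j'))))
                 (sum-sign n (toℕ j) (λ j' → signₚ (toℕ j') (F (suc j) (suc j')))))))
      (doubleAltSum-vanishes n (λ j j' → F (suc j) (suc j')) rest)

liftCols : ∀ {q k} → (Fin q → Fin k) → Fin (suc q) → Fin (suc k)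
liftCols τ zero    = zero
liftCols τ (suc c) = suc (τ c)

ColumnExtensional : ∀ {q k} → ((Fin q → Fin k) → Poly) → Set
ColumnExtensional {q} {k} E = ∀ (σ τ : Fin q → Fin k) → (∀ c → σ c ≡ τ c) → E σ ≈ E τ

pairTerms : ∀ q (x : Fin (suc (suc q)) → Poly) (E : (Fin q → Fin (suc (suc q))) → Poly) →
            Fin (suc (suc q)) → Fin (suc q) → Poly
pairTerms q x E j j' = x j *ₚ (x (punchIn j j') *ₚ E (λ c → punchIn j (punchIn j' c)))

pairTerms-symmetric : ∀ q x E → ColumnExtensional E → PairSymmetric (suc q) (pairTerms q x E)
pairTerms-symmetric zero    x E ext = (λ { zero → *-swap (x zero) (x (suc zero)) _ }) , tt
pairTerms-symmetric (suc q) x E ext =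
  (λ j → *-swap (x zero) (x (suc j)) _) ,
  PairSymmetric-cong (suc q)
    (λ j j' → *-congʳ (x (suc j)) (*-congʳ (x (suc (punchIn j j')))
      (ext (liftCols (λ c → punchIn j (punchIn j' c))) (λ c → punchIn (suc j) (punchIn (suc j') c))
           (λ { zero → refl ; (suc c) → refl }))))
    (pairTerms-symmetric q (λ j → x (suc j)) (λ τ → E (liftCols τ))
      (λ σ τ e → ext (liftCols σ) (liftCols τ) (λ { zero → refl ; (suc c) → cong suc (e c) })))

-- Rows 0 and 1 equal: expand along both and cancel in pairs.
det-rows01-equal : ∀ m (M : Mat (suc (suc m))) → (∀ c → M (suc zero) c ≈ M zero c) →
                   det (suc (suc m)) M ≈ []
det-rows01-equal m M row1≈row0 = begin
  det (suc (suc m)) M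
    ≈⟨ altSum-cong (suc (suc m)) (λ j → ≈-trans (*-sum (suc m) (M zero j) (λ j' → signₚ (toℕ j') (t j j')))
         (sum-cong (suc m) (λ j' → ≈-trans (sign-*ʳ (toℕ j') (M zero j) (t j j'))
           (sign-cong (toℕ j') (*-congʳ (M zero j) (*-congˡ (D j j') (row1≈row0 (punchIn j j')))))))) ⟩
  doubleAltSum (suc m) (pairTerms m (M zero) E)
    ≈⟨ doubleAltSum-vanishes (suc m) (pairTerms m (M zero) E) (pairTerms-symmetric m (M zero) E E-ext) ⟩
  [] ∎
  where
    open ≈-Reasoning
    E : (Fin m → Fin (suc (suc m))) → Poly
    E σ = det m (λ r c → M (suc (suc r)) (σ c))
    E-ext : ColumnExtensional E
    E-ext σ τ eq = det-cong m (λ r c → ≈-reflexive (cong (M (suc (suc r))) (eq c)))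
    D : Fin (suc (suc m)) → Fin (suc m) → Poly
    D j j' = E (λ c → punchIn j (punchIn j' c))
    t : Fin (suc (suc m)) → Fin (suc m) → Poly
    t j j' = M (suc zero) (punchIn j j') *ₚ D j j'

-- A with rows p and q replaced by u and w (p wins if p = q).
replaceRows : ∀ {m} → Fin m → Fin m → (Fin m → Poly) → (Fin m → Poly) → Mat m → Mat m
replaceRows p q u w A r with r Fin.≟ p | r Fin.≟ q
... | yes _ | _     = u
... | no _  | yes _ = w
... | no _  | no _  = A r

module _ {m : ℕ} (p q : Fin m) (p≢q : p ≢ q) (A : Mat m) where

  replaceRows-p : ∀ u w c → replaceRows p q u w A p c ≈ u c
  replaceRows-p u w c with p Fin.≟ p
  ... | yes _   = ≈-refl
  ... | no p≢p = ⊥-elim (p≢p refl)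

  replaceRows-q : ∀ u w c → replaceRows p q u w A q c ≈ w c
  replaceRows-q u w c with q Fin.≟ p | q Fin.≟ q
  ... | yes q≡p | _      = ⊥-elim (p≢q (sym q≡p))
  ... | no _    | yes _  = ≈-refl
  ... | no _    | no q≢q = ⊥-elim (q≢q refl)

  replaceRows-other : ∀ u w r c → r ≢ p → r ≢ q → replaceRows p q u w A r c ≈ A r c
  replaceRows-other u w r c r≢p r≢q with r Fin.≟ p | r Fin.≟ q
  ... | yes r≡p | _       = ⊥-elim (r≢p r≡p)
  ... | no _    | yes r≡q = ⊥-elim (r≢q r≡q)
  ... | no _    | no _    = ≈-refl

  det-replace-+ₚ : ∀ u₁ u₂ w → det m (replaceRows p q (λ c → u₁ c +ₚ u₂ c) w A) ≈
                                (det m (replaceRows p q u₁ w A) +ₚ det m (replaceRows p q u₂ w A))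
  det-replace-+ₚ u₁ u₂ w =
    ≈-trans (det-lin m 1ℚ 1ℚ M₁ M₂ M p row-p (agree u₁) (agree u₂)) (lin-1-1 (det m M₁) (det m M₂))
    where
      M₁ M₂ M : Mat m
      M₁ = replaceRows p q u₁ w A
      M₂ = replaceRows p q u₂ w A
      M  = replaceRows p q (λ c → u₁ c +ₚ u₂ c) w A
      row-p : ∀ c → M p c ≈ lin 1ℚ 1ℚ (M₁ p c) (M₂ p c)
      row-p c = ≈-trans (replaceRows-p _ w c) (≈-sym (≈-trans (lin-1-1 (M₁ p c) (M₂ p c))
                  (+-cong (replaceRows-p u₁ w c) (replaceRows-p u₂ w c))))
      agree : ∀ u r → r ≢ p → ∀ c → replaceRows p q u w A r c ≈ M r c
      agree u r r≢p c with r Fin.≟ p | r Fin.≟ q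
      ... | yes r≡p | _     = ⊥-elim (r≢p r≡p)
      ... | no _    | yes _ = ≈-refl
      ... | no _    | no _  = ≈-refl

  det-replace-+q : ∀ u w₁ w₂ → det m (replaceRows p q u (λ c → w₁ c +ₚ w₂ c) A) ≈
                                (det m (replaceRows p q u w₁ A) +ₚ det m (replaceRows p q u w₂ A))
  det-replace-+q u w₁ w₂ =
    ≈-trans (det-lin m 1ℚ 1ℚ M₁ M₂ M q row-q (agree w₁) (agree w₂)) (lin-1-1 (det m M₁) (det m M₂))
    where
      M₁ M₂ M : Mat m
      M₁ = replaceRows p q u w₁ A
      M₂ = replaceRows p q u w₂ A
      M  = replaceRows p q u (λ c → w₁ c +ₚ w₂ c) A
      row-q : ∀ c → M q c ≈ lin 1ℚ 1ℚ (M₁ q c) (M₂ q c)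
      row-q c = ≈-trans (replaceRows-q u _ c) (≈-sym (≈-trans (lin-1-1 (M₁ q c) (M₂ q c))
                  (+-cong (replaceRows-q u w₁ c) (replaceRows-q u w₂ c))))
      agree : ∀ w r → r ≢ q → ∀ c → replaceRows p q u w A r c ≈ M r c
      agree w r r≢q c with r Fin.≟ p | r Fin.≟ q
      ... | yes _ | _       = ≈-refl
      ... | no _  | yes r≡q = ⊥-elim (r≢q r≡q)
      ... | no _  | no _    = ≈-refl

Alternating : ℕ → Set
Alternating m = ∀ (M : Mat m) p q → p ≢ q → (∀ c → M p c ≈ M q c) → det m M ≈ []

record RowsSwapped {m} (A B : Mat m) (p q : Fin m) : Set where
  field
    distinct  : p ≢ q
    at-p      : ∀ c → A p c ≈ B q c
    at-q      : ∀ c → A q c ≈ B p c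
    elsewhere : ∀ r → r ≢ p → r ≢ q → ∀ c → A r c ≈ B r c

SwapNegates : ℕ → Set
SwapNegates m = ∀ (A B : Mat m) p q → RowsSwapped A B p q → (det m A +ₚ det m B) ≈ []

-- Polarisation: with u, w the rows p, q of A and S = u + w,
-- 0 = det(S, S) = det(u, u) + det(u, w) + det(w, u) + det(w, w) = det A + det B.
alternating⇒swapNegates : ∀ m → Alternating m → SwapNegates m
alternating⇒swapNegates m alt A B p q swapped = begin
  det m A +ₚ det m B
    ≈⟨ +-cong (≈-sym (+-[]ˡ (equalRows u))) (≈-sym (+-[]ʳ (equalRows w))) ⟩
  (det m (rep u u) +ₚ det m A) +ₚ (det m B +ₚ det m (rep w w))
    ≈⟨ +-cong (≈-trans (det-replace-+q p q p≢q A u u w) (+-congˡ (det m (rep u u)) (det-cong m rep-u-w≈A)))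
              (≈-trans (det-replace-+q p q p≢q A w u w) (+-cong (det-cong m rep-w-u≈B) (≈-refl {det m (rep w w)}))) ⟨
  det m (rep u S) +ₚ det m (rep w S)
    ≈⟨ det-replace-+ₚ p q p≢q A u w S ⟨
  det m (rep S S)
    ≈⟨ equalRows S ⟩
  [] ∎
  where
    open ≈-Reasoning
    open RowsSwapped swapped
    p≢q = distinct
    u w S : Fin m → Poly
    u = A p
    w = A q
    S c = u c +ₚ w c
    rep : (Fin m → Poly) → (Fin m → Poly) → Mat m
    rep x y = replaceRows p q x y A
    equalRows : ∀ x → det m (rep x x) ≈ []
    equalRows x = alt (rep x x) p q p≢q
      (λ c → ≈-trans (replaceRows-p p q p≢q A x x c) (≈-sym (replaceRows-q p q p≢q A x x c)))
    rep-u-w≈A : ∀ r c → rep u w r c ≈ A r c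
    rep-u-w≈A r c with r Fin.≟ p | r Fin.≟ q
    ... | yes refl | _        = ≈-refl
    ... | no _     | yes refl = ≈-refl
    ... | no _     | no _     = ≈-refl
    rep-w-u≈B : ∀ r c → rep w u r c ≈ B r c
    rep-w-u≈B r c with r Fin.≟ p | r Fin.≟ q
    ... | yes refl | _        = at-q c
    ... | no _     | yes refl = at-p c
    ... | no r≢p   | no r≢q   = elsewhere r r≢p r≢q c

-- Exchanging two rows other than row 0 negates det, by expansion along
-- row 0 and the corresponding fact for the minors.
swapNegates-belowRow0 : ∀ m → SwapNegates m → ∀ (A B : Mat (suc m)) p q →
  RowsSwapped A B (suc p) (suc q) → (det (suc m) A +ₚ det (suc m) B) ≈ []
swapNegates-belowRow0 m swap A B p q swapped = begin
  det (suc m) A +ₚ det (suc m) B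
    ≈⟨ sum-+ (suc m) (λ j → signₚ (toℕ j) (a j)) (λ j → signₚ (toℕ j) (b j)) ⟨
  sumFinₚ (suc m) (λ j → signₚ (toℕ j) (a j) +ₚ signₚ (toℕ j) (b j))
    ≈⟨ sum-[] (suc m) (λ j → ≈-trans (≈-sym (sign-+ (toℕ j) (a j) (b j)))
                                      (sign-[] (toℕ j) (terms-cancel j))) ⟩
  [] ∎
  where
    open ≈-Reasoning
    open RowsSwapped swapped
    a b : Fin (suc m) → Poly
    a j = A zero j *ₚ det m (minor A j)
    b j = B zero j *ₚ det m (minor B j)
    minors-swapped : ∀ j → RowsSwapped (minor A j) (minor B j) p q
    minors-swapped j = record
      { distinct  = λ p≡q → distinct (cong suc p≡q)
      ; at-p      = λ c → at-p (punchIn j c)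
      ; at-q      = λ c → at-q (punchIn j c)
      ; elsewhere = λ r r≢p r≢q c → elsewhere (suc r) (λ e → r≢p (FinP.suc-injective e))
                                                     (λ e → r≢q (FinP.suc-injective e)) (punchIn j c) }
    terms-cancel : ∀ j → (a j +ₚ b j) ≈ []
    terms-cancel j = begin
      a j +ₚ b j
        ≈⟨ +-congˡ (a j) (*-congˡ (det m (minor B j)) (≈-sym (elsewhere zero (λ ()) (λ ()) j))) ⟩
      a j +ₚ (A zero j *ₚ det m (minor B j))
        ≈⟨ *-distribˡ (A zero j) (det m (minor A j)) (det m (minor B j)) ⟨
      A zero j *ₚ (det m (minor A j) +ₚ det m (minor B j))
        ≈⟨ *-congʳ (A zero j) (swap (minor A j) (minor B j) p q (minors-swapped j)) ⟩
      A zero j *ₚ []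
        ≈⟨ *-[]ʳ (A zero j) ⟩
      [] ∎

-- Row 0 equal to row q+1: exchange rows 1 and q+1 (which negates det)
-- to reach a matrix whose rows 0 and 1 agree.
det-row0-equal : ∀ m → Alternating m → (M : Mat (suc m)) → ∀ q →
                 (∀ c → M zero c ≈ M (suc q) c) → det (suc m) M ≈ []
det-row0-equal (suc m) _   M zero    eq = det-rows01-equal m M (λ c → ≈-sym (eq c))
det-row0-equal (suc m) alt M (suc q) eq = begin
  det (suc (suc m)) M
    ≈⟨ +-[]ʳ detB≈[] ⟨
  det (suc (suc m)) M +ₚ det (suc (suc m)) B
    ≈⟨ swapNegates-belowRow0 (suc m) (alternating⇒swapNegates (suc m) alt) M B zero (suc q) swapped ⟩
  [] ∎
  where
    open ≈-Reasoning
    one other : Fin (suc (suc m))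
    one   = suc zero
    other = suc (suc q)
    one≢other : one ≢ other
    one≢other ()
    B : Mat (suc (suc m))
    B = replaceRows one other (M other) (M one) M
    swapped : RowsSwapped M B one other
    swapped = record
      { distinct  = one≢other
      ; at-p      = λ c → ≈-sym (replaceRows-q one other one≢other M (M other) (M one) c)
      ; at-q      = λ c → ≈-sym (replaceRows-p one other one≢other M (M other) (M one) c)
      ; elsewhere = λ r r≢one r≢other c →
          ≈-sym (replaceRows-other one other one≢other M (M other) (M one) r c r≢one r≢other) }
    detB≈[] : det (suc (suc m)) B ≈ []
    detB≈[] = det-rows01-equal m B (λ c → begin
      B one c    ≈⟨ replaceRows-p one other one≢other M (M other) (M one) c ⟩
      M other c  ≈⟨ eq c ⟨
      M zero c   ≈⟨ replaceRows-other one other one≢other M (M other) (M one) zero c (λ ()) (λ ()) ⟨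
      B zero c   ∎)

-- The determinant is alternating, by induction on the size: if neither
-- equal row is row 0, expand along row 0.
det-alternating : ∀ m → Alternating m
det-alternating zero    M () q p≢q eq
det-alternating (suc m) M zero    zero    p≢q eq = ⊥-elim (p≢q refl)
det-alternating (suc m) M zero    (suc q) p≢q eq = det-row0-equal m (det-alternating m) M q eq
det-alternating (suc m) M (suc p) zero    p≢q eq = det-row0-equal m (det-alternating m) M p (λ c → ≈-sym (eq c))
det-alternating (suc m) M (suc p) (suc q) p≢q eq = sum-[] (suc m) λ j → sign-[] (toℕ j)
  (≈-trans (*-congʳ (M zero j)
             (det-alternating m (minor M j) p q (λ e → p≢q (cong suc e)) (λ c → eq (punchIn j c))))
           (*-[]ʳ (M zero j)))

-- Degree bounds

-- DegLe packaged as a record, so that p and d can be inferred.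
record Deg (p : Poly) (d : ℤ) : Set where
  constructor mkDeg
  field deg : DegLe p d
open Deg public

Deg-cong : ∀ {p q d} → p ≈ q → Deg p d → Deg q d
Deg-cong e D = mkDeg λ m lt → trans (sym (app e m)) (deg D m lt)

Deg-mono : ∀ {p d e} → d ℤ.≤ e → Deg p d → Deg p e
Deg-mono le D = mkDeg λ m lt → deg D m (ℤP.≤-<-trans le lt)

Deg-[] : ∀ {p} d → p ≈ [] → Deg p d
Deg-[] d e = mkDeg λ m lt → app e m

Deg-+ : ∀ {p q d} → Deg p d → Deg q d → Deg (p +ₚ q) d
Deg-+ {p} {q} Dp Dq = mkDeg λ m lt →
  trans (coeff-+ p q m) (trans (cong₂ ℚ._+_ (deg Dp m lt) (deg Dq m lt)) (ℚP.+-identityˡ 0ℚ))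

Deg-scale : ∀ c {p d} → Deg p d → Deg (scaleₚ c p) d
Deg-scale c {p} D = mkDeg λ m lt →
  trans (coeff-scale c p m) (trans (cong (c ℚ.*_) (deg D m lt)) (ℚP.*-zeroʳ c))

Deg-sign : ∀ n {p d} → Deg p d → Deg (signₚ n p) d
Deg-sign n {p} D = Deg-cong (≈-sym (sign≈ n p)) (Deg-scale (signℚ n) D)

Deg-lin : ∀ α β {p q d} → Deg p d → Deg q d → Deg (lin α β p q) d
Deg-lin α β Dp Dq = Deg-+ (Deg-scale α Dp) (Deg-scale β Dq)

Deg-sum : ∀ m {f : Fin m → Poly} {d} → (∀ j → Deg (f j) d) → Deg (sumFinₚ m f) d
Deg-sum zero    D = mkDeg λ m lt → refl
Deg-sum (suc m) D = Deg-+ (D zero) (Deg-sum m (λ j → D (suc j)))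

+suc : ∀ m → + suc m ≡ + m ℤ.+ + 1
+suc m = cong +_ (ℕP.+-comm 1 m)

Deg-tail : ∀ {c p d} → Deg (c ∷ p) d → Deg p (d ℤ.- + 1)
Deg-tail {d = d} D = mkDeg λ m lt →
  deg D (suc m) (subst₂ ℤ._<_ (lemma d) (sym (+suc m)) (ℤP.+-monoˡ-< (+ 1) lt))
  where
    lemma : ∀ d → (d ℤ.- + 1) ℤ.+ + 1 ≡ d
    lemma = solve-∀

Deg-shift : ∀ {p d} → Deg p d → Deg (0ℚ ∷ p) (d ℤ.+ + 1)
Deg-shift {d = d} D = mkDeg λ
  { zero    lt → refl
  ; (suc m) lt → deg D m (cancel-+1 (subst (d ℤ.+ + 1 ℤ.<_) (+suc m) lt)) }
  where
    cancel-+1 : ∀ {x y} → x ℤ.+ + 1 ℤ.< y ℤ.+ + 1 → x ℤ.< y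
    cancel-+1 {x} {y} lt = subst₂ ℤ._<_ (lemma x) (lemma y) (ℤP.+-monoˡ-< (ℤ.- + 1) lt)
      where
        lemma : ∀ x → (x ℤ.+ + 1) ℤ.+ ℤ.- + 1 ≡ x
        lemma = solve-∀

Deg-* : ∀ p {q d e} → Deg p d → Deg q e → Deg (p *ₚ q) (d ℤ.+ e)
Deg-* []      Dp Dq = mkDeg λ m lt → refl
Deg-* (c ∷ p) {q} {d} {e} Dp Dq = Deg-+ constant-part shifted-part
  where
    -- c·q: if d < 0 then c = 0, else deg ≤ e ≤ d + e
    constant-part : Deg (scaleₚ c q) (d ℤ.+ e)
    constant-part with + 0 ℤ.≤? d
    ... | yes 0≤d = Deg-scale c (Deg-mono (subst (ℤ._≤ d ℤ.+ e) (ℤP.+-identityˡ e) (ℤP.+-monoˡ-≤ e 0≤d)) Dq)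
    ... | no  0≰d = Deg-[] _ (≈-trans (scale-cong (deg Dp zero (ℤP.≰⇒> 0≰d)) ≈-refl) (scale-0 q))
    shifted-part : Deg (0ℚ ∷ (p *ₚ q)) (d ℤ.+ e)
    shifted-part = Deg-mono (ℤP.≤-reflexive (lemma d e)) (Deg-shift (Deg-* p (Deg-tail Dp) Dq))
      where
        lemma : ∀ d e → ((d ℤ.- + 1) ℤ.+ e) ℤ.+ + 1 ≡ d ℤ.+ e
        lemma = solve-∀

sumFinℤ-punchIn : ∀ m (v : Fin (suc m) → ℤ) j →
  sumFinℤ (suc m) v ≡ v j ℤ.+ sumFinℤ m (λ c → v (punchIn j c))
sumFinℤ-punchIn m       v zero    = refl
sumFinℤ-punchIn (suc m) v (suc j) = trans
  (cong (λ x → v zero ℤ.+ x) (sumFinℤ-punchIn m (λ c → v (suc c)) j))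
  (lemma (v zero) (v (suc j)) (sumFinℤ m (λ c → v (suc (punchIn j c)))))
  where
    lemma : ∀ a b s → a ℤ.+ (b ℤ.+ s) ≡ b ℤ.+ (a ℤ.+ s)
    lemma = solve-∀

-- If deg M r c ≤ u r + v c for all r, c then deg det M ≤ Σ u + Σ v,
-- since every term of the cofactor expansion is a product over a
-- permutation.
det-degree : ∀ m (M : Mat m) (u v : Fin m → ℤ) → (∀ r c → Deg (M r c) (u r ℤ.+ v c)) →
             Deg (det m M) (sumFinℤ m u ℤ.+ sumFinℤ m v)
det-degree zero    M u v D = mkDeg λ { zero lt → ⊥-elim (ℤP.<-irrefl refl lt) ; (suc m) lt → refl }
det-degree (suc m) M u v D = Deg-sum (suc m) λ j → Deg-sign (toℕ j)
  (Deg-mono (ℤP.≤-reflexive (weights j))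
    (Deg-* (M zero j) (D zero j)
      (det-degree m (minor M j) (λ r → u (suc r)) (λ c → v (punchIn j c)) (λ r c → D (suc r) (punchIn j c)))))
  where
    lemma : ∀ a b U V → (a ℤ.+ b) ℤ.+ (U ℤ.+ V) ≡ (a ℤ.+ U) ℤ.+ (b ℤ.+ V)
    lemma = solve-∀
    weights : ∀ j → (u zero ℤ.+ v j) ℤ.+ (sumFinℤ m (λ r → u (suc r)) ℤ.+ sumFinℤ m (λ c → v (punchIn j c)))
                  ≡ sumFinℤ (suc m) u ℤ.+ sumFinℤ (suc m) v
    weights j = trans (lemma (u zero) (v j) _ _)
      (cong (λ x → sumFinℤ (suc m) u ℤ.+ x) (sym (sumFinℤ-punchIn m v j)))

-- Sums of distinct natural numbers

sumFinℕ : ∀ m → (Fin m → ℕ) → ℕ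
sumFinℕ zero    f = 0
sumFinℕ (suc m) f = f zero ℕ.+ sumFinℕ m (λ j → f (suc j))

triangle : ℕ → ℕ
triangle zero    = 0
triangle (suc m) = m ℕ.+ triangle m

sumFinℕ-punchIn : ∀ m (h : Fin (suc m) → ℕ) j →
  sumFinℕ (suc m) h ≡ h j ℕ.+ sumFinℕ m (λ c → h (punchIn j c))
sumFinℕ-punchIn m       h zero    = refl
sumFinℕ-punchIn (suc m) h (suc j) = begin
  h zero ℕ.+ sumFinℕ (suc m) (λ c → h (suc c))
    ≡⟨ cong (h zero ℕ.+_) (sumFinℕ-punchIn m (λ c → h (suc c)) j) ⟩
  h zero ℕ.+ (h (suc j) ℕ.+ rest)
    ≡⟨ ℕP.+-assoc (h zero) (h (suc j)) rest ⟨
  (h zero ℕ.+ h (suc j)) ℕ.+ rest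
    ≡⟨ cong (ℕ._+ rest) (ℕP.+-comm (h zero) (h (suc j))) ⟩
  (h (suc j) ℕ.+ h zero) ℕ.+ rest
    ≡⟨ ℕP.+-assoc (h (suc j)) (h zero) rest ⟩
  h (suc j) ℕ.+ (h zero ℕ.+ rest) ∎
  where
    open ≡-Reasoning
    rest = sumFinℕ m (λ c → h (suc (punchIn j c)))

argmax : ∀ m (h : Fin (suc m) → ℕ) → Σ (Fin (suc m)) λ t → ∀ r → h r ℕ.≤ h t
argmax zero    h = zero , λ { zero → ℕP.≤-refl }
argmax (suc m) h with argmax m (λ r → h (suc r))
... | t , h≤ht with h zero ℕ.≤? h (suc t)
...   | yes h0≤ht = suc t , λ { zero → h0≤ht ; (suc r) → h≤ht r }
...   | no  h0≰ht = zero , λ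
  { zero    → ℕP.≤-refl
  ; (suc r) → ℕP.≤-trans (h≤ht r) (ℕP.<⇒≤ (ℕP.≰⇒> h0≰ht)) }

-- m distinct naturals sum to at least 0 + 1 + ... + (m - 1): the largest
-- one dominates m distinct smaller values, so it is at least m - 1
-- (pigeonhole), and the rest follows by induction.
triangle≤sum-injective : ∀ m (h : Fin m → ℕ) → (∀ r r' → h r ≡ h r' → r ≡ r') →
                         triangle m ℕ.≤ sumFinℕ m h
triangle≤sum-injective zero    h inj = ℕP.≤-refl
triangle≤sum-injective (suc m) h inj with argmax m h
... | t , h≤ht = subst (triangle (suc m) ℕ.≤_) (sym (sumFinℕ-punchIn m h t))
      (ℕP.+-mono-≤ m≤ht (triangle≤sum-injective m (λ c → h (punchIn t c))
        (λ r r' e → FinP.punchIn-injective t r r' (inj _ _ e))))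
  where
    below-max : ∀ c → h (punchIn t c) ℕ.< h t
    below-max c = ℕP.≤∧≢⇒< (h≤ht (punchIn t c)) (λ e → FinP.punchInᵢ≢i t c (inj _ _ e))
    m≤ht : m ℕ.≤ h t
    m≤ht with m ℕ.≤? h t
    ... | yes m≤ht = m≤ht
    ... | no  m≰ht with FinP.pigeonhole (ℕP.≰⇒> m≰ht) (λ c → Fin.fromℕ< (below-max c))
    ...   | i , j , i<j , same = ⊥-elim (ℕP.<⇒≢ i<j (cong toℕ
              (FinP.punchIn-injective t i j (inj _ _ (begin
                h (punchIn t i)                         ≡⟨ FinP.toℕ-fromℕ< (below-max i) ⟨
                toℕ (Fin.fromℕ< (below-max i))          ≡⟨ cong toℕ same ⟩
                toℕ (Fin.fromℕ< (below-max j))          ≡⟨ FinP.toℕ-fromℕ< (below-max j) ⟩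
                h (punchIn t j)                         ∎)))))
      where open ≡-Reasoning

sumFinℤ-pos : ∀ m (f : Fin m → ℕ) → sumFinℤ m (λ i → + f i) ≡ + sumFinℕ m f
sumFinℤ-pos zero    f = refl
sumFinℤ-pos (suc m) f = trans (cong (λ x → + f zero ℤ.+ x) (sumFinℤ-pos m (λ i → f (suc i))))
  (sym (ℤP.pos-+ (f zero) _))

sumFinℤ-neg : ∀ m (h : Fin m → ℕ) → sumFinℤ m (λ r → ℤ.- + h r) ≡ ℤ.- + sumFinℕ m h
sumFinℤ-neg zero    h = refl
sumFinℤ-neg (suc m) h = begin
  ℤ.- + h zero ℤ.+ sumFinℤ m (λ r → ℤ.- + h (suc r))
    ≡⟨ cong (λ x → ℤ.- + h zero ℤ.+ x) (sumFinℤ-neg m (λ r → h (suc r))) ⟩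
  ℤ.- + h zero ℤ.+ ℤ.- + rest
    ≡⟨ ℤP.neg-distrib-+ (+ h zero) (+ rest) ⟨
  ℤ.- (+ h zero ℤ.+ + rest)
    ≡⟨ cong ℤ.-_ (ℤP.pos-+ (h zero) rest) ⟨
  ℤ.- + (h zero ℕ.+ rest) ∎
  where
    open ≡-Reasoning
    rest = sumFinℕ m (λ r → h (suc r))

-- The expansion theorem

sumUpTo : ℕ → (ℕ → Poly) → Poly
sumUpTo zero    f = []
sumUpTo (suc L) f = f 0 +ₚ sumUpTo L (λ l → f (suc l))

sumUpTo-cong : ∀ L {f g : ℕ → Poly} → (∀ l → f l ≈ g l) → sumUpTo L f ≈ sumUpTo L g
sumUpTo-cong zero    e = ≈-refl
sumUpTo-cong (suc L) e = +-cong (e 0) (sumUpTo-cong L (λ l → e (suc l)))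

sumUpTo-+ : ∀ L (f g : ℕ → Poly) → sumUpTo L (λ l → f l +ₚ g l) ≈ (sumUpTo L f +ₚ sumUpTo L g)
sumUpTo-+ zero    f g = ≈-refl
sumUpTo-+ (suc L) f g = ≈-trans
  (+-congˡ (f 0 +ₚ g 0) (sumUpTo-+ L (λ l → f (suc l)) (λ l → g (suc l))))
  (+-interchange (f 0) (g 0) (sumUpTo L (λ l → f (suc l))) (sumUpTo L (λ l → g (suc l))))

sumUpTo-[] : ∀ L {f : ℕ → Poly} → (∀ l → f l ≈ []) → sumUpTo L f ≈ []
sumUpTo-[] zero    e = ≈-refl
sumUpTo-[] (suc L) e = ≈-trans (+-[]ˡ (e 0)) (sumUpTo-[] L (λ l → e (suc l)))

replaceRow : ∀ {m} → Fin m → (Fin m → Poly) → Mat m → Mat m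
replaceRow r w M r' with r' Fin.≟ r
... | yes _ = w
... | no _  = M r'

replaceRow-at : ∀ {m} (r : Fin m) w M c → replaceRow r w M r c ≈ w c
replaceRow-at r w M c with r Fin.≟ r
... | yes _   = ≈-refl
... | no r≢r = ⊥-elim (r≢r refl)

replaceRow-other : ∀ {m} (r : Fin m) w M r' c → r' ≢ r → replaceRow r w M r' c ≈ M r' c
replaceRow-other r w M r' c r'≢r with r' Fin.≟ r
... | yes r'≡r = ⊥-elim (r'≢r r'≡r)
... | no _     = ≈-refl

replaceRow-twice : ∀ {m} (r : Fin m) w w' M r' c →
  replaceRow r w (replaceRow r w' M) r' c ≈ replaceRow r w M r' c
replaceRow-twice r w w' M r' c with r' Fin.≟ r
... | yes _    = ≈-refl
... | no r'≢r = replaceRow-other r w' M r' c r'≢r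

record LinComb {m} (R : ℕ → Fin m → Poly) (row : Fin m → Poly) : Set where
  field
    length    : ℕ
    coef      : ℕ → ℚ
    index     : ℕ → ℕ
    expansion : ∀ c → row c ≈ sumUpTo length (λ l → scaleₚ (coef l) (R (index l) c))

LinComb-cong : ∀ {m} {R : ℕ → Fin m → Poly} {row row'} → (∀ c → row c ≈ row' c) →
               LinComb R row → LinComb R row'
LinComb-cong e comb = record
  { length = length ; coef = coef ; index = index
  ; expansion = λ c → ≈-trans (≈-sym (e c)) (expansion c) }
  where open LinComb comb

module Expansion (m : ℕ) (v : Fin m → ℤ) (R : ℕ → Fin m → Poly)
                 (R-degree : ∀ l c → Deg (R l c) (v c ℤ.- + l)) where

  bound : ℤ
  bound = sumFinℤ m v ℤ.- + triangle m

  -- If row r is R (h r) for every r: two equal indices give two equal rows,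
  -- otherwise the weighted degree bound applies with Σ h ≥ triangle m.
  det-basisRows : ∀ (M : Mat m) (h : Fin m → ℕ) → (∀ r c → M r c ≈ R (h r) c) → Deg (det m M) bound
  det-basisRows M h rows with FinP.any? (λ r → FinP.any? (λ r' → ¬? (r Fin.≟ r') ×-dec (h r ℕ.≟ h r')))
  ... | yes (r , r' , r≢r' , same) = Deg-[] _ (det-alternating m M r r' r≢r'
          (λ c → ≈-trans (rows r c) (≈-trans (≈-reflexive (cong (λ l → R l c) same)) (≈-sym (rows r' c)))))
  ... | no no-repeat = Deg-mono weights≤bound (det-degree m M (λ r → ℤ.- + h r) v entry-degree)
    where
      entry-degree : ∀ r c → Deg (M r c) (ℤ.- + h r ℤ.+ v c)
      entry-degree r c = Deg-cong (≈-sym (rows r c))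
        (Deg-mono (ℤP.≤-reflexive (ℤP.+-comm (v c) (ℤ.- + h r))) (R-degree (h r) c))
      h-injective : ∀ r r' → h r ≡ h r' → r ≡ r'
      h-injective r r' same with r Fin.≟ r'
      ... | yes r≡r' = r≡r'
      ... | no r≢r'  = ⊥-elim (no-repeat (r , r' , r≢r' , same))
      weights≤bound : sumFinℤ m (λ r → ℤ.- + h r) ℤ.+ sumFinℤ m v ℤ.≤ bound
      weights≤bound = subst (ℤ._≤ bound)
        (trans (ℤP.+-comm (sumFinℤ m v) (ℤ.- + sumFinℕ m h)) (cong (ℤ._+ sumFinℤ m v) (sym (sumFinℤ-neg m h))))
        (ℤP.+-monoʳ-≤ (sumFinℤ m v) (ℤP.neg-mono-≤ (ℤ.+≤+ (triangle≤sum-injective m h h-injective))))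

  det-expandRow : ∀ {d} L (M : Mat m) r (coef : ℕ → ℚ) (g : ℕ → ℕ) →
    (∀ c → M r c ≈ sumUpTo L (λ l → scaleₚ (coef l) (R (g l) c))) →
    (∀ l → Deg (det m (replaceRow r (R (g l)) M)) d) → Deg (det m M) d
  det-expandRow zero M r coef g row-r D = Deg-[] _ (begin
    det m M
      ≈⟨ det-lin m 0ℚ 0ℚ M M M r (λ c → ≈-trans (row-r c) (≈-sym (zero-lin (M r c))))
                 (λ _ _ _ → ≈-refl) (λ _ _ _ → ≈-refl) ⟩
    lin 0ℚ 0ℚ (det m M) (det m M)
      ≈⟨ zero-lin (det m M) ⟩
    [] ∎)
    where
      open ≈-Reasoning
      zero-lin : ∀ p → lin 0ℚ 0ℚ p p ≈ []
      zero-lin p = ≈-trans (+-[]ˡ (scale-0 p)) (scale-0 p)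
  det-expandRow (suc L) M r coef g row-r D =
    Deg-cong (≈-sym (det-lin m (coef 0) 1ℚ first others M r
        (λ c → ≈-trans (row-r c) (≈-sym (+-cong (scale-cong refl (replaceRow-at r (R (g 0)) M c))
                                                 (≈-trans (scale-1 _) (replaceRow-at r rest M c)))))
        (λ r' r'≢r c → replaceRow-other r (R (g 0)) M r' c r'≢r)
        (λ r' r'≢r c → replaceRow-other r rest M r' c r'≢r)))
      (Deg-lin (coef 0) 1ℚ (D 0)
        (det-expandRow L others r (λ l → coef (suc l)) (λ l → g (suc l)) (replaceRow-at r rest M)
          (λ l → Deg-cong (det-cong m (λ r' c → ≈-sym (replaceRow-twice r (R (g (suc l))) rest M r' c)))
                          (D (suc l)))))
    where
      rest : Fin m → Poly
      rest c = sumUpTo L (λ l → scaleₚ (coef (suc l)) (R (g (suc l)) c))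
      first others : Mat m
      first  = replaceRow r (R (g 0)) M
      others = replaceRow r rest M

  PartlyExpanded : ℕ → Set
  PartlyExpanded k = ∀ (M : Mat m) (h : Fin m → ℕ) → (∀ r → toℕ r ℕ.< k → LinComb R (M r)) →
    (∀ r → k ℕ.≤ toℕ r → ∀ c → M r c ≈ R (h r) c) → Deg (det m M) bound

  -- Induction on k: expand row k and apply the hypothesis to each summand.
  partlyExpanded-degree : ∀ k → PartlyExpanded k
  partlyExpanded-degree zero M h _ basis = det-basisRows M h (λ r c → basis r ℕ.z≤n c)
  partlyExpanded-degree (suc k) M h comb basis with k ℕ.<? m
  ... | no k≮m = partlyExpanded-degree k M h (λ r lt → comb r (ℕP.m≤n⇒m≤1+n lt))
                   (λ r k≤r → ⊥-elim (k≮m (ℕP.≤-<-trans k≤r (FinP.toℕ<n r))))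
  ... | yes k<m = det-expandRow length M rk coef index expansion (λ l →
                    partlyExpanded-degree k (replaceRow rk (R (index l)) M) (h' l) comb' (basis' l))
    where
      rk : Fin m
      rk = Fin.fromℕ< k<m
      toℕ-rk : toℕ rk ≡ k
      toℕ-rk = FinP.toℕ-fromℕ< k<m
      open LinComb (comb rk (subst (ℕ._< suc k) (sym toℕ-rk) ℕP.≤-refl))
      h' : ℕ → Fin m → ℕ
      h' l r with r Fin.≟ rk
      ... | yes _ = index l
      ... | no _  = h r
      comb' : ∀ {w} r → toℕ r ℕ.< k → LinComb R (replaceRow rk w M r)
      comb' {w} r r<k = LinComb-cong
        (λ c → ≈-sym (replaceRow-other rk w M r c
                        (λ r≡rk → ℕP.<-irrefl (trans (cong toℕ r≡rk) toℕ-rk) r<k)))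
        (comb r (ℕP.m≤n⇒m≤1+n r<k))
      basis' : ∀ l r → k ℕ.≤ toℕ r → ∀ c → replaceRow rk (R (index l)) M r c ≈ R (h' l r) c
      basis' l r k≤r c with r Fin.≟ rk
      ... | yes refl = ≈-refl
      ... | no r≢rk  = basis r (ℕP.≤∧≢⇒< k≤r k≢r) c
        where
          k≢r : k ≢ toℕ r
          k≢r k≡r = r≢rk (FinP.toℕ-injective (trans (sym k≡r) (sym toℕ-rk)))

  expansion-degree : ∀ (M : Mat m) → (∀ r → LinComb R (M r)) → Deg (det m M) bound
  expansion-degree M comb = partlyExpanded-degree m M (λ _ → 0) (λ r _ → comb r)
    (λ r m≤r → ⊥-elim (ℕP.<-irrefl refl (ℕP.≤-<-trans m≤r (FinP.toℕ<n r))))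

module ℚSolver = Data.Rational.Solver.+-*-Solver

fromℕ : ℕ → ℚ
fromℕ n = + n ℚ./ 1

fromℕ-ᵘ : ∀ n → ℚ.toℚᵘ (fromℕ n) ℚᵘ.≃ mkℚᵘ (+ n) 0
fromℕ-ᵘ n = ℚP.toℚᵘ-fromℚᵘ (mkℚᵘ (+ n) 0)

fromℕ-+ : ∀ a b → fromℕ (a ℕ.+ b) ≡ fromℕ a ℚ.+ fromℕ b
fromℕ-+ a b = ℚP.toℚᵘ-injective (ℚᵘP.≃-trans (fromℕ-ᵘ (a ℕ.+ b)) (ℚᵘP.≃-trans (ℚᵘ.*≡* integral)
  (ℚᵘP.≃-sym (ℚᵘP.≃-trans (ℚP.toℚᵘ-homo-+ (fromℕ a) (fromℕ b))
                          (ℚᵘP.+-cong (fromℕ-ᵘ a) (fromℕ-ᵘ b))))))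
  where
    lemma : ∀ x y → (x ℤ.+ y) ℤ.* + 1 ≡ ((x ℤ.* + 1) ℤ.+ (y ℤ.* + 1)) ℤ.* + 1
    lemma = solve-∀
    integral : + (a ℕ.+ b) ℤ.* + 1 ≡ ((+ a ℤ.* + 1) ℤ.+ (+ b ℤ.* + 1)) ℤ.* + 1
    integral = trans (cong (ℤ._* + 1) (ℤP.pos-+ a b)) (lemma (+ a) (+ b))

fromℕ-* : ∀ a b → fromℕ (a ℕ.* b) ≡ fromℕ a ℚ.* fromℕ b
fromℕ-* a b = ℚP.toℚᵘ-injective (ℚᵘP.≃-trans (fromℕ-ᵘ (a ℕ.* b)) (ℚᵘP.≃-trans (ℚᵘ.*≡* integral)
  (ℚᵘP.≃-sym (ℚᵘP.≃-trans (ℚP.toℚᵘ-homo-* (fromℕ a) (fromℕ b))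
                          (ℚᵘP.*-cong (fromℕ-ᵘ a) (fromℕ-ᵘ b))))))
  where
    integral : + (a ℕ.* b) ℤ.* + 1 ≡ (+ a ℤ.* + b) ℤ.* + 1
    integral = cong (ℤ._* + 1) (ℤP.pos-* a b)

reciprocal-inverse : ∀ d .{{_ : ℕ.NonZero d}} → (+ 1 ℚ./ d) ℚ.* fromℕ d ≡ 1ℚ
reciprocal-inverse zero    {{d≢0}} = Irrelevant.⊥-elim (ℕ.≢-nonZero⁻¹ zero {{d≢0}} refl)
reciprocal-inverse (suc d) = ℚP.toℚᵘ-injective
  (ℚᵘP.≃-trans (ℚP.toℚᵘ-homo-* (+ 1 ℚ./ suc d) (fromℕ (suc d)))
  (ℚᵘP.≃-trans (ℚᵘP.*-cong (ℚP.toℚᵘ-fromℚᵘ (mkℚᵘ (+ 1) d)) (fromℕ-ᵘ (suc d)))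
                (ℚᵘ.*≡* integral)))
  where
    lemma : ∀ x → (+ 1 ℤ.* x) ℤ.* + 1 ≡ + 1 ℤ.* x
    lemma = solve-∀
    integral : (+ 1 ℤ.* + suc d) ℤ.* + 1 ≡ + 1 ℤ.* + suc (d ℕ.* 1)
    integral = trans (lemma (+ suc d)) (cong (λ z → + 1 ℤ.* + suc z) (sym (ℕP.*-identityʳ d)))

1/! : ℕ → ℚ
1/! m = (+ 1 ℚ./ (m ℕ.!)) {{m ℕP.!≢0}}

1/!-suc : ∀ m → 1/! (suc m) ℚ.* fromℕ (suc m) ≡ 1/! m
1/!-suc m = begin
  u ℚ.* fromℕ (suc m)
    ≡⟨ ℚP.*-identityʳ _ ⟨
  (u ℚ.* fromℕ (suc m)) ℚ.* 1ℚ
    ≡⟨ cong ((u ℚ.* fromℕ (suc m)) ℚ.*_) m!/m! ⟨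
  (u ℚ.* fromℕ (suc m)) ℚ.* (fromℕ (m ℕ.!) ℚ.* 1/! m)
    ≡⟨ regroup u (fromℕ (suc m)) (fromℕ (m ℕ.!)) (1/! m) ⟩
  (u ℚ.* (fromℕ (suc m) ℚ.* fromℕ (m ℕ.!))) ℚ.* 1/! m
    ≡⟨ cong (λ z → (u ℚ.* z) ℚ.* 1/! m) (fromℕ-* (suc m) (m ℕ.!)) ⟨
  (u ℚ.* fromℕ (suc m ℕ.!)) ℚ.* 1/! m
    ≡⟨ cong (ℚ._* 1/! m) (reciprocal-inverse (suc m ℕ.!) {{suc m ℕP.!≢0}}) ⟩
  1ℚ ℚ.* 1/! m
    ≡⟨ ℚP.*-identityˡ (1/! m) ⟩
  1/! m ∎
  where
    open ≡-Reasoning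
    u = 1/! (suc m)
    m!/m! : fromℕ (m ℕ.!) ℚ.* 1/! m ≡ 1ℚ
    m!/m! = trans (ℚP.*-comm (fromℕ (m ℕ.!)) (1/! m)) (reciprocal-inverse (m ℕ.!) {{m ℕP.!≢0}})
    regroup : ∀ a b c d → (a ℚ.* b) ℚ.* (c ℚ.* d) ≡ (a ℚ.* (b ℚ.* c)) ℚ.* d
    regroup = solve 4 (λ a b c d → (a :* b) :* (c :* d) := (a :* (b :* c)) :* d) refl
      where open ℚSolver

-- Binomial polynomials: Pascal and Vandermonde

falling-cong : ∀ {x x'} m → x ≈ x' → falling x m ≈ falling x' m
falling-cong zero    e = ≈-refl
falling-cong (suc m) e = *-cong (falling-cong m e) (+-cong e ≈-refl)

binom-cong : ∀ {x x'} k → x ≈ x' → binomₚ x k ≈ binomₚ x' k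
binom-cong (+ m)    e = scale-cong refl (falling-cong m e)
binom-cong -[1+ m ] e = ≈-refl

binom-index : ∀ x {k k'} → k ≡ k' → binomₚ x k ≈ binomₚ x k'
binom-index x refl = ≈-refl

falling-shift : ∀ x m → falling (x +ₚ 1ₚ) (suc m) ≈ ((x +ₚ 1ₚ) *ₚ falling x m)
falling-shift x zero    = ≈-trans (*-identityˡ _) (≈-trans (+-[]ʳ 0∷[]≈[]) (≈-sym (*-identityʳ _)))
falling-shift x (suc m) = begin
  falling y (suc m) *ₚ (y +ₚ constₚ (ℚ.- fromℕ (suc m)))  ≈⟨ *-cong (falling-shift x m) last-factor ⟩
  (y *ₚ falling x m) *ₚ (x +ₚ constₚ (ℚ.- fromℕ m))       ≈⟨ *-assoc y (falling x m) _ ⟩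
  y *ₚ falling x (suc m)                                  ∎
  where
    open ≈-Reasoning
    y = x +ₚ 1ₚ
    constant : 1ℚ ℚ.+ ℚ.- fromℕ (suc m) ≡ ℚ.- fromℕ m
    constant = trans (cong (λ z → 1ℚ ℚ.+ ℚ.- z) (fromℕ-+ 1 m))
      (solve 1 (λ a → con 1ℚ :+ :- (con 1ℚ :+ a) := :- a) refl (fromℕ m))
      where open ℚSolver
    last-factor : (y +ₚ constₚ (ℚ.- fromℕ (suc m))) ≈ (x +ₚ constₚ (ℚ.- fromℕ m))
    last-factor = ≈-trans (+-assoc x 1ₚ _) (+-congˡ x (∷-cong constant ≈-refl))

pascal : ∀ x k → binomₚ (x +ₚ 1ₚ) k ≈ (binomₚ x k +ₚ binomₚ x (k ℤ.- + 1))
pascal x -[1+ n ]  = ≈-refl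
pascal x (+ zero)  = ≈-sym (+-identityʳ _)
pascal x (+ suc m) = begin
  scaleₚ u (falling y (suc m))
    ≈⟨ scale-cong refl (≈-trans (falling-shift x m) split) ⟩
  scaleₚ u ((f *ₚ (x +ₚ constₚ (ℚ.- fromℕ m))) +ₚ scaleₚ (fromℕ (suc m)) f)
    ≈⟨ scale-+ₚ u (f *ₚ (x +ₚ constₚ (ℚ.- fromℕ m))) (scaleₚ (fromℕ (suc m)) f) ⟩
  scaleₚ u (f *ₚ (x +ₚ constₚ (ℚ.- fromℕ m))) +ₚ scaleₚ u (scaleₚ (fromℕ (suc m)) f)
    ≈⟨ +-congˡ (scaleₚ u (f *ₚ (x +ₚ constₚ (ℚ.- fromℕ m))))
                (≈-trans (scale-scale u (fromℕ (suc m)) f) (scale-cong (1/!-suc m) ≈-refl)) ⟩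
  scaleₚ u (falling x (suc m)) +ₚ scaleₚ (1/! m) f ∎
  where
    open ≈-Reasoning
    y = x +ₚ 1ₚ
    u = 1/! (suc m)
    f = falling x m
    constant : ℚ.- fromℕ m ℚ.+ fromℕ (suc m) ≡ 1ℚ
    constant = trans (cong (λ z → ℚ.- fromℕ m ℚ.+ z) (fromℕ-+ 1 m))
      (solve 1 (λ a → :- a :+ (con 1ℚ :+ a) := con 1ℚ) refl (fromℕ m))
      where open ℚSolver
    split : (y *ₚ f) ≈ ((f *ₚ (x +ₚ constₚ (ℚ.- fromℕ m))) +ₚ scaleₚ (fromℕ (suc m)) f)
    split = begin
      (x +ₚ 1ₚ) *ₚ f
        ≈⟨ *-distribʳ x 1ₚ f ⟩
      (x *ₚ f) +ₚ (1ₚ *ₚ f)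
        ≈⟨ +-cong (*-comm x f) (≈-trans (*-identityˡ f) (≈-sym (scale-1 f))) ⟩
      (f *ₚ x) +ₚ scaleₚ 1ℚ f
        ≈⟨ +-congˡ (f *ₚ x) (≈-trans (scale-cong (sym constant) ≈-refl)
                                     (scale-+ℚ (ℚ.- fromℕ m) (fromℕ (suc m)) f)) ⟩
      (f *ₚ x) +ₚ (scaleₚ (ℚ.- fromℕ m) f +ₚ scaleₚ (fromℕ (suc m)) f)
        ≈⟨ +-assoc (f *ₚ x) _ _ ⟨
      ((f *ₚ x) +ₚ scaleₚ (ℚ.- fromℕ m) f) +ₚ scaleₚ (fromℕ (suc m)) f
        ≈⟨ +-cong (+-congˡ (f *ₚ x) (≈-sym (*-constʳ f (ℚ.- fromℕ m))))
                  (≈-refl {scaleₚ (fromℕ (suc m)) f}) ⟩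
      ((f *ₚ x) +ₚ (f *ₚ constₚ (ℚ.- fromℕ m))) +ₚ scaleₚ (fromℕ (suc m)) f
        ≈⟨ +-cong (≈-sym (*-distribˡ f x (constₚ (ℚ.- fromℕ m)))) (≈-refl {scaleₚ (fromℕ (suc m)) f}) ⟩
      (f *ₚ (x +ₚ constₚ (ℚ.- fromℕ m))) +ₚ scaleₚ (fromℕ (suc m)) f ∎

natₚ-suc : ∀ x N → (x +ₚ natₚ (suc N)) ≈ ((x +ₚ natₚ N) +ₚ 1ₚ)
natₚ-suc x N = ≈-trans (+-congˡ x (∷-cong constant ≈-refl)) (≈-sym (+-assoc x (natₚ N) 1ₚ))
  where
    constant : fromℕ (suc N) ≡ fromℕ N ℚ.+ 1ℚ
    constant = trans (cong fromℕ (ℕP.+-comm 1 N)) (fromℕ-+ N 1)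

vandermondeTerm : ℕ → Poly → ℤ → ℕ → Poly
vandermondeTerm N x k l = scaleₚ (fromℕ (N choose l)) (binomₚ x (k ℤ.- + l))

vandermondeTerm-pascal : ∀ N x k l →
  (vandermondeTerm N x k (suc l) +ₚ scaleₚ (fromℕ (N choose l)) (binomₚ x ((k ℤ.- + 1) ℤ.- + l)))
    ≈ vandermondeTerm (suc N) x k (suc l)
vandermondeTerm-pascal N x k l = begin
  scaleₚ c₁ p +ₚ scaleₚ c₀ (binomₚ x ((k ℤ.- + 1) ℤ.- + l))
    ≈⟨ +-congˡ (scaleₚ c₁ p) (scale-cong refl (binom-index x index)) ⟩
  scaleₚ c₁ p +ₚ scaleₚ c₀ p
    ≈⟨ +-comm (scaleₚ c₁ p) (scaleₚ c₀ p) ⟩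
  scaleₚ c₀ p +ₚ scaleₚ c₁ p
    ≈⟨ scale-+ℚ c₀ c₁ p ⟨
  scaleₚ (c₀ ℚ.+ c₁) p
    ≈⟨ scale-cong (trans (sym (fromℕ-+ (N choose l) (N choose suc l)))
                         (cong fromℕ (nCk+nC[k+1]≡[n+1]C[k+1] N l))) ≈-refl ⟩
  scaleₚ (fromℕ (suc N choose suc l)) p ∎
  where
    open ≈-Reasoning
    c₀ c₁ : ℚ
    c₀ = fromℕ (N choose l)
    c₁ = fromℕ (N choose suc l)
    p = binomₚ x (k ℤ.- + suc l)
    index : (k ℤ.- + 1) ℤ.- + l ≡ k ℤ.- + suc l
    index = trans (lemma k (+ l)) (cong (λ z → k ℤ.- z) (sym (+suc l)))
      where
        lemma : ∀ a b → (a ℤ.- + 1) ℤ.- b ≡ a ℤ.- (b ℤ.+ + 1)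
        lemma = solve-∀

vandermonde : ∀ N L → N ℕ.< L → ∀ x k → binomₚ (x +ₚ natₚ N) k ≈ sumUpTo L (vandermondeTerm N x k)
vandermonde zero (suc L) _ x k = begin
  binomₚ (x +ₚ natₚ 0) k                        ≈⟨ binom-cong k (+-[]ʳ 0∷[]≈[]) ⟩
  binomₚ x k                                     ≈⟨ binom-index x (sym (ℤP.+-identityʳ k)) ⟩
  binomₚ x (k ℤ.- + 0)                           ≈⟨ scale-1 _ ⟨
  scaleₚ 1ℚ (binomₚ x (k ℤ.- + 0))               ≈⟨ +-[]ʳ (sumUpTo-[] L (λ l → scale-0 _)) ⟨
  sumUpTo (suc L) (vandermondeTerm 0 x k)        ∎
  where open ≈-Reasoning
vandermonde (suc N) (suc L) (ℕ.s≤s N<L) x k = begin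
  binomₚ (x +ₚ natₚ (suc N)) k
    ≈⟨ binom-cong k (natₚ-suc x N) ⟩
  binomₚ ((x +ₚ natₚ N) +ₚ 1ₚ) k
    ≈⟨ pascal (x +ₚ natₚ N) k ⟩
  binomₚ (x +ₚ natₚ N) k +ₚ binomₚ (x +ₚ natₚ N) (k ℤ.- + 1)
    ≈⟨ +-cong (vandermonde N (suc L) (ℕP.m≤n⇒m≤1+n N<L) x k) (vandermonde N L N<L x (k ℤ.- + 1)) ⟩
  (vandermondeTerm N x k 0 +ₚ sumUpTo L (λ l → vandermondeTerm N x k (suc l)))
    +ₚ sumUpTo L (vandermondeTerm N x (k ℤ.- + 1))
    ≈⟨ +-assoc (vandermondeTerm N x k 0) _ _ ⟩
  vandermondeTerm N x k 0 +ₚ (sumUpTo L (λ l → vandermondeTerm N x k (suc l))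
                              +ₚ sumUpTo L (vandermondeTerm N x (k ℤ.- + 1)))
    ≈⟨ +-congˡ (vandermondeTerm N x k 0) (≈-trans
         (≈-sym (sumUpTo-+ L (λ l → vandermondeTerm N x k (suc l)) (vandermondeTerm N x (k ℤ.- + 1))))
         (sumUpTo-cong L (vandermondeTerm-pascal N x k))) ⟩
  sumUpTo (suc L) (vandermondeTerm (suc N) x k) ∎
  where open ≈-Reasoning

Deg-const : ∀ c → Deg (constₚ c) (+ 0)
Deg-const c = mkDeg λ { zero (ℤ.+<+ ()) ; (suc m) lt → refl }

Deg-+const : ∀ {x} c → Deg x (+ 1) → Deg (x +ₚ constₚ c) (+ 1)
Deg-+const c D = Deg-+ D (Deg-mono (ℤ.+≤+ ℕ.z≤n) (Deg-const c))

falling-degree : ∀ {x} m → Deg x (+ 1) → Deg (falling x m) (+ m)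
falling-degree zero    D = Deg-const 1ℚ
falling-degree {x} (suc m) D = Deg-mono (ℤP.≤-reflexive (sym (+suc m)))
  (Deg-* (falling x m) (falling-degree m D) (Deg-+const _ D))

binom-degree : ∀ {x} k → Deg x (+ 1) → Deg (binomₚ x k) k
binom-degree (+ m)    D = Deg-scale _ (falling-degree m D)
binom-degree -[1+ m ] D = Deg-[] _ ≈-refl

Deg-X : Deg Xₚ (+ 1)
Deg-X = mkDeg λ { zero (ℤ.+<+ ()) ; (suc zero) (ℤ.+<+ (ℕ.s≤s ())) ; (suc (suc m)) lt → refl }

Deg-halfX : Deg halfXₚ (+ 1)
Deg-halfX = mkDeg λ { zero (ℤ.+<+ ()) ; (suc zero) (ℤ.+<+ (ℕ.s≤s ())) ; (suc (suc m)) lt → refl }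

binomRow : ∀ {m} → (Fin m → ℤ) → (Fin m → Poly) → ℕ → Fin m → Poly
binomRow v var l c = binomₚ (var c) (v c ℤ.- + l)

binomRow-degree : ∀ {m} (v : Fin m → ℤ) (var : Fin m → Poly) → (∀ c → Deg (var c) (+ 1)) →
                  ∀ l c → Deg (binomRow v var l c) (v c ℤ.- + l)
binomRow-degree v var linear l c = binom-degree (v c ℤ.- + l) (linear c)

vandermonde-row : ∀ {m} (v : Fin m → ℤ) (var : Fin m → Poly) (row : Fin m → Poly) N o →
  (∀ c → row c ≈ binomₚ (var c +ₚ natₚ N) (v c ℤ.- + o)) → LinComb (binomRow v var) row
vandermonde-row v var row N o shape = record
  { length = suc N ; coef = λ l → fromℕ (N choose l) ; index = λ l → o ℕ.+ l
  ; expansion = λ c → ≈-trans (shape c) (≈-trans (vandermonde N (suc N) ℕP.≤-refl (var c) (v c ℤ.- + o))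
      (sumUpTo-cong (suc N) (λ l → scale-cong {fromℕ (N choose l)} refl (binom-index (var c) (index-+ (v c) o l))))) }
  where
    index-+ : ∀ a o l → (a ℤ.- + o) ℤ.- + l ≡ a ℤ.- + (o ℕ.+ l)
    index-+ a o l = trans (lemma a (+ o) (+ l)) (cong (λ z → a ℤ.- z) (sym (ℤP.pos-+ o l)))
      where
        lemma : ∀ a x y → (a ℤ.- x) ℤ.- y ≡ a ℤ.- (x ℤ.+ y)
        lemma = solve-∀

sumFinℤ-cong : ∀ m {f g : Fin m → ℤ} → (∀ i → f i ≡ g i) → sumFinℤ m f ≡ sumFinℤ m g
sumFinℤ-cong zero    e = refl
sumFinℤ-cong (suc m) e = cong₂ ℤ._+_ (e zero) (sumFinℤ-cong m (λ i → e (suc i)))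

sumFinℤ-split : ∀ s b (f : Fin (s ℕ.+ b) → ℤ) →
  sumFinℤ (s ℕ.+ b) f ≡ sumFinℤ s (λ i → f (i Fin.↑ˡ b)) ℤ.+ sumFinℤ b (λ j → f (s Fin.↑ʳ j))
sumFinℤ-split zero    b f = sym (ℤP.+-identityˡ _)
sumFinℤ-split (suc s) b f = trans (cong (λ x → f zero ℤ.+ x) (sumFinℤ-split s b (λ i → f (suc i))))
  (sym (ℤP.+-assoc (f zero) _ _))

sumFinℤ-sub : ∀ m (f g : Fin m → ℤ) → sumFinℤ m (λ i → f i ℤ.- g i) ≡ sumFinℤ m f ℤ.- sumFinℤ m g
sumFinℤ-sub zero    f g = refl
sumFinℤ-sub (suc m) f g = trans
  (cong (λ x → (f zero ℤ.- g zero) ℤ.+ x) (sumFinℤ-sub m (λ i → f (suc i)) (λ i → g (suc i))))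
  (lemma (f zero) (g zero) _ _)
  where
    lemma : ∀ a b c d → (a ℤ.- b) ℤ.+ (c ℤ.- d) ≡ (a ℤ.+ c) ℤ.- (b ℤ.+ d)
    lemma = solve-∀

sumFinℕ-cong : ∀ m {f g : Fin m → ℕ} → (∀ i → f i ≡ g i) → sumFinℕ m f ≡ sumFinℕ m g
sumFinℕ-cong zero    e = refl
sumFinℕ-cong (suc m) e = cong₂ ℕ._+_ (e zero) (sumFinℕ-cong m (λ i → e (suc i)))

sumFinℕ-arith : ∀ b c → sumFinℕ b (λ j → c ℕ.+ toℕ j) ≡ b ℕ.* c ℕ.+ triangle b
sumFinℕ-arith zero    c = refl
sumFinℕ-arith (suc b) c = trans
  (cong (λ x → (c ℕ.+ 0) ℕ.+ x)
        (trans (sumFinℕ-cong b (λ j → ℕP.+-suc c (toℕ j))) (sumFinℕ-arith b (suc c))))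
  (lemma b c (triangle b))
  where
    lemma : ∀ b c T → (c ℕ.+ 0) ℕ.+ (b ℕ.* (1 ℕ.+ c) ℕ.+ T) ≡ (c ℕ.+ b ℕ.* c) ℕ.+ (b ℕ.+ T)
    lemma = ℕSolver.solve-∀

triangle-+ : ∀ s b → triangle (s ℕ.+ b) ≡ triangle s ℕ.+ (s ℕ.* b ℕ.+ triangle b)
triangle-+ zero    b = refl
triangle-+ (suc s) b =
  trans (cong (λ x → (s ℕ.+ b) ℕ.+ x) (triangle-+ s b)) (lemma s b (triangle s) (triangle b))
  where
    lemma : ∀ s b P T → (s ℕ.+ b) ℕ.+ (P ℕ.+ (s ℕ.* b ℕ.+ T)) ≡ (s ℕ.+ P) ℕ.+ ((b ℕ.+ s ℕ.* b) ℕ.+ T)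
    lemma = ℕSolver.solve-∀

-- The matrix B̄_J^J

BbarBlock : (n b k : ℕ) → Fin (n ℕ.+ b) ⊎ Fin b → Fin (n ℕ.+ b) ⊎ Fin b → Poly
BbarBlock n b k (inj₁ i) (inj₁ j) = binomₚ (Xₚ +ₚ natₚ (toℕ i ℕ.+ toℕ j)) (+ toℕ j)
BbarBlock n b k (inj₁ i) (inj₂ j) = binomₚ (halfXₚ +ₚ natₚ (k ℕ.+ toℕ i)) (+ (2 ℕ.* k ℕ.+ toℕ j))
BbarBlock n b k (inj₂ i) (inj₁ j) = binomₚ (Xₚ +ₚ natₚ (n ℕ.+ b ℕ.+ toℕ j)) (+ toℕ j ℤ.- + toℕ i)
BbarBlock n b k (inj₂ i) (inj₂ j) =
  binomₚ (halfXₚ +ₚ natₚ (n ℕ.+ b ℕ.+ k)) (+ (2 ℕ.* k ℕ.+ toℕ j) ℤ.- + toℕ i)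

Bbar-blocks : ∀ n b k r c →
  Bbar n b k r c ≡ BbarBlock n b k (Fin.splitAt (n ℕ.+ b) r) (Fin.splitAt (n ℕ.+ b) c)
Bbar-blocks n b k r c with Fin.splitAt (n ℕ.+ b) r | Fin.splitAt (n ℕ.+ b) c
... | inj₁ i | inj₁ j = refl
... | inj₁ i | inj₂ j = refl
... | inj₂ i | inj₁ j = refl
... | inj₂ i | inj₂ j = refl

natₚ-+ʳ : ∀ x a b → (x +ₚ natₚ (a ℕ.+ b)) ≈ ((x +ₚ natₚ b) +ₚ natₚ a)
natₚ-+ʳ x a b = ≈-trans (+-congˡ x (∷-cong (trans (cong fromℕ (ℕP.+-comm a b)) (fromℕ-+ b a)) ≈-refl))
  (≈-sym (+-assoc x (natₚ b) (natₚ a)))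

natₚ-+ˡ : ∀ x a b → (x +ₚ natₚ (a ℕ.+ b)) ≈ ((x +ₚ natₚ a) +ₚ natₚ b)
natₚ-+ˡ x a b = ≈-trans (+-congˡ x (∷-cong (fromℕ-+ a b) ≈-refl))
  (≈-sym (+-assoc x (natₚ a) (natₚ b)))

module PrincipalMinor (n b k s : ℕ) (ι : Fin s → Fin (n ℕ.+ b)) where

  Jblock : Set
  Jblock = Fin s ⊎ Fin b

  columnVar : Jblock → Poly
  columnVar (inj₁ i) = Xₚ +ₚ natₚ (toℕ (ι i))
  columnVar (inj₂ j) = halfXₚ +ₚ natₚ k

  columnWeight : Jblock → ℤ
  columnWeight (inj₁ i) = + toℕ (ι i)
  columnWeight (inj₂ j) = + (2 ℕ.* k ℕ.+ toℕ j)

  rowShift rowOffset : Jblock → ℕ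
  rowShift  (inj₁ i) = toℕ (ι i)
  rowShift  (inj₂ j) = n ℕ.+ b
  rowOffset (inj₁ i) = 0
  rowOffset (inj₂ j) = toℕ j

  entry-shape : ∀ x y → BbarBlock n b k (Sum.map₁ ι x) (Sum.map₁ ι y) ≈
    binomₚ (columnVar y +ₚ natₚ (rowShift x)) (columnWeight y ℤ.- + rowOffset x)
  entry-shape (inj₁ i) (inj₁ j) =
    ≈-trans (binom-cong (+ toℕ (ι j)) (natₚ-+ʳ Xₚ (toℕ (ι i)) (toℕ (ι j))))
            (binom-index _ (sym (ℤP.+-identityʳ (+ toℕ (ι j)))))
  entry-shape (inj₁ i) (inj₂ j) =
    ≈-trans (binom-cong (+ (2 ℕ.* k ℕ.+ toℕ j)) (natₚ-+ˡ halfXₚ k (toℕ (ι i))))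
            (binom-index _ (sym (ℤP.+-identityʳ (+ (2 ℕ.* k ℕ.+ toℕ j)))))
  entry-shape (inj₂ i) (inj₁ j) =
    binom-cong (+ toℕ (ι j) ℤ.- + toℕ i) (natₚ-+ʳ Xₚ (n ℕ.+ b) (toℕ (ι j)))
  entry-shape (inj₂ i) (inj₂ j) =
    binom-cong (+ (2 ℕ.* k ℕ.+ toℕ j) ℤ.- + toℕ i) (natₚ-+ʳ halfXₚ (n ℕ.+ b) k)

  M : Mat (s ℕ.+ b)
  M = BbarJJ n b k s ι

  block : Fin (s ℕ.+ b) → Jblock
  block = Fin.splitAt s

  M-blocks : ∀ t t' → M t t' ≡ BbarBlock n b k (Sum.map₁ ι (block t)) (Sum.map₁ ι (block t'))
  M-blocks t t' = trans (Bbar-blocks n b k _ _)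
    (cong₂ (BbarBlock n b k) (FinP.splitAt-join (n ℕ.+ b) b (Sum.map₁ ι (block t)))
                             (FinP.splitAt-join (n ℕ.+ b) b (Sum.map₁ ι (block t'))))

  weight : Fin (s ℕ.+ b) → ℤ
  weight t = columnWeight (block t)

  var : Fin (s ℕ.+ b) → Poly
  var t = columnVar (block t)

  var-linear : ∀ t → Deg (var t) (+ 1)
  var-linear t with block t
  ... | inj₁ i = Deg-+const (fromℕ (toℕ (ι i))) Deg-X
  ... | inj₂ j = Deg-+const (fromℕ k) Deg-halfX

  rows-combine : ∀ t → LinComb (binomRow weight var) (M t)
  rows-combine t = vandermonde-row weight var (M t) (rowShift (block t)) (rowOffset (block t))
    (λ t' → ≈-trans (≈-reflexive (M-blocks t t')) (entry-shape (block t) (block t')))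

  open Expansion (s ℕ.+ b) weight (binomRow weight var) (binomRow-degree weight var var-linear)

  det-degree-bound : Deg (det (s ℕ.+ b) M) bound
  det-degree-bound = expansion-degree M rows-combine

  bound-value : bound ≡ sumFinℤ s (λ t → + toℕ (ι t) ℤ.- + toℕ t) ℤ.+ + (2 ℕ.* b ℕ.* k) ℤ.- + (b ℕ.* s)
  bound-value = begin
    sumFinℤ (s ℕ.+ b) weight ℤ.- + triangle (s ℕ.+ b)
      ≡⟨ cong₂ ℤ._-_ weight-sum (cong +_ triangle-sum) ⟩
    (A ℤ.+ + (K ℕ.+ T)) ℤ.- + (P ℕ.+ (Q ℕ.+ T))
      ≡⟨ cong₂ (λ x y → (A ℤ.+ x) ℤ.- y) (ℤP.pos-+ K T)
               (trans (ℤP.pos-+ P (Q ℕ.+ T)) (cong (λ z → + P ℤ.+ z) (ℤP.pos-+ Q T))) ⟩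
    (A ℤ.+ (+ K ℤ.+ + T)) ℤ.- (+ P ℤ.+ (+ Q ℤ.+ + T))
      ≡⟨ regroup A (+ K) (+ T) (+ P) (+ Q) ⟩
    (A ℤ.- + P) ℤ.+ + K ℤ.- + Q
      ≡⟨ cong (λ x → x ℤ.+ + K ℤ.- + Q) selected-sum ⟨
    sumFinℤ s (λ t → + toℕ (ι t) ℤ.- + toℕ t) ℤ.+ + K ℤ.- + Q ∎
    where
      open ≡-Reasoning
      A : ℤ
      A = sumFinℤ s (λ i → + toℕ (ι i))
      K T P Q : ℕ
      K = 2 ℕ.* b ℕ.* k
      T = triangle b
      P = triangle s
      Q = b ℕ.* s
      regroup : ∀ A K T P Q → (A ℤ.+ (K ℤ.+ T)) ℤ.- (P ℤ.+ (Q ℤ.+ T)) ≡ (A ℤ.- P) ℤ.+ K ℤ.- Q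
      regroup = solve-∀
      weight-sum : sumFinℤ (s ℕ.+ b) weight ≡ A ℤ.+ + (K ℕ.+ T)
      weight-sum = trans (sumFinℤ-split s b weight) (cong₂ ℤ._+_
        (sumFinℤ-cong s (λ i → cong columnWeight (FinP.splitAt-↑ˡ s i b)))
        (trans (sumFinℤ-cong b (λ j → cong columnWeight (FinP.splitAt-↑ʳ s b j)))
          (trans (sumFinℤ-pos b (λ j → 2 ℕ.* k ℕ.+ toℕ j))
            (cong +_ (trans (sumFinℕ-arith b (2 ℕ.* k)) (cong (ℕ._+ T) (lemma b k)))))))
        where
          lemma : ∀ b k → b ℕ.* (2 ℕ.* k) ≡ 2 ℕ.* b ℕ.* k
          lemma = ℕSolver.solve-∀
      triangle-sum : triangle (s ℕ.+ b) ≡ P ℕ.+ (Q ℕ.+ T)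
      triangle-sum = trans (triangle-+ s b) (cong (λ z → P ℕ.+ (z ℕ.+ T)) (ℕP.*-comm s b))
      selected-sum : sumFinℤ s (λ t → + toℕ (ι t) ℤ.- + toℕ t) ≡ A ℤ.- + P
      selected-sum = trans (sumFinℤ-sub s (λ t → + toℕ (ι t)) (λ t → + toℕ t))
        (cong (λ x → A ℤ.- x) (trans (sumFinℤ-pos s toℕ)
          (cong +_ (trans (sumFinℕ-arith s 0) (cong (ℕ._+ P) (ℕP.*-zeroʳ s))))))

lemma8 : (n b k : ℕ) → 2 ∣ b → (s : ℕ) → (ι : Fin s → Fin (n ℕ.+ b)) →
    (∀ {x y} → x Fin.< y → ι x Fin.< ι y) →
    DegLe (det (s ℕ.+ b) (BbarJJ n b k s ι))
      (sumFinℤ s (λ t → + toℕ (ι t) ℤ.- + toℕ t) ℤ.+ + (2 ℕ.* b ℕ.* k) ℤ.- + (b ℕ.* s))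
lemma8 n b k _ s ι _ = subst (DegLe (det (s ℕ.+ b) M)) bound-value (deg det-degree-bound)
  where open PrincipalMinor n b k s ι
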